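{- For every integer $n\geq 0$ and any indeterminate $y$, \[ \sum_{k=0}^{n}(-1)^{n-k}\binom{n}{k}L_{n,k}(y+1)^{k}=\sum_{k=0}^{n}\binom{n}{k}(k+1)^{k-1}y^{k}, \qquad \sum_{k=0}^{n}\binom{n}{k}L_{n,k}\,y^{k} = \sum_{k=0}^{n}(-1)^{n-k}\binom{n}{k}(k+1)^{k-1}(y+1)^{k}. \]
   Context: A labeled forest on a finite set $S$ is a set of rooted trees whose vertex sets partition $S$; a singleton tree is a tree with exactly one vertex. For $0\le k\le n$, $L_{n,k}$ is the number of labeled forests on $[n+1]=\{1,\dots,n+1\}$ in which $\{k+1\}$ is a singleton tree and no $i>k+1$ forms a singleton tree. $(0+1)^{ -1}=1$. -}

module Defs where

open import Data.Nat using (ℕ; zero; suc; _∸_; _<_; _<?_; _^_; _≟_)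
open import Data.Fin using (Fin; toℕ)
open import Data.Fin.Properties using (all?) renaming (_≟_ to _≟F_)
open import Data.Maybe using (Maybe; nothing; just)
open import Data.Maybe.Properties using (≡-dec)
open import Data.List using (List; []; _∷_; map; concatMap; length; filter; allFin)
open import Data.Vec using (Vec; []; _∷_; lookup)
open import Data.Product using (_×_; _,_)
open import Relation.Binary.PropositionalEquality using (_≡_; _≢_)
open import Relation.Nullary using (Dec; ¬_; ¬?)
open import Relation.Nullary.Decidable using (_×-dec_; _→-dec_)
open import Relation.Unary using (Decidable)
open import Algebra.Bundles using (CommutativeRing; Semiring)
open import Level using (Level)

-- Rooted labelled forests on the vertex set Fin m, encoded by their
-- parent function: f v ≡ nothing means v is a root, f v ≡ just u means
-- u is the parent of v.  Such a function describes a rooted forest iff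
-- it has no cycle, i.e. following parents from any vertex reaches a
-- root (after at most m steps).

ParentMap : ℕ → Set
ParentMap m = Vec (Maybe (Fin m)) m

step : ∀ {m} → ParentMap m → Maybe (Fin m) → Maybe (Fin m)
step f nothing  = nothing
step f (just v) = lookup f v

iter : ∀ {A : Set} → (A → A) → ℕ → A → A
iter g zero    a = a
iter g (suc k) a = g (iter g k a)

IsForest : ∀ {m} → ParentMap m → Set
IsForest {m} f = ∀ (v : Fin m) → iter (step f) m (just v) ≡ nothing

IsSingleton : ∀ {m} → ParentMap m → Fin m → Set
IsSingleton {m} f v = (lookup f v ≡ nothing) × (∀ (u : Fin m) → lookup f u ≢ just v)

-- Vertex set [n+1] = {1,…,n+1} is encoded as Fin (suc n), with label i
-- corresponding to the index i-1.  So the label k+1 is the index with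
-- toℕ ≡ k, and "label i > k+1" is "toℕ j > k".
LCond : (n k : ℕ) → ParentMap (suc n) → Set
LCond n k f =
  IsForest f
  × (∀ (j : Fin (suc n)) → toℕ j ≡ k → IsSingleton f j)
  × (∀ (j : Fin (suc n)) → k < toℕ j → ¬ IsSingleton f j)

isForest? : ∀ {m} (f : ParentMap m) → Dec (IsForest f)
isForest? {m} f = all? (λ v → ≡-dec _≟F_ (iter (step f) m (just v)) nothing)

isSingleton? : ∀ {m} (f : ParentMap m) (v : Fin m) → Dec (IsSingleton f v)
isSingleton? f v =
  ≡-dec _≟F_ (lookup f v) nothing
  ×-dec all? (λ u → ¬? (≡-dec _≟F_ (lookup f u) (just v)))

LCond? : (n k : ℕ) → Decidable (LCond n k)
LCond? n k f =
  isForest? f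
  ×-dec all? (λ j → (toℕ j ≟ k) →-dec isSingleton? f j)
  ×-dec all? (λ j → (k <? toℕ j) →-dec ¬? (isSingleton? f j))

allVecs : ∀ {A : Set} → List A → (k : ℕ) → List (Vec A k)
allVecs xs zero    = [] ∷ []
allVecs xs (suc k) = concatMap (λ x → map (x ∷_) (allVecs xs k)) xs

allParentMaps : (m : ℕ) → List (ParentMap m)
allParentMaps m = allVecs (nothing ∷ map just (allFin m)) m

L : ℕ → ℕ → ℕ
L n k = length (filter (LCond? n k) (allParentMaps (suc n)))

-- (k+1)^(k-1), with the convention (0+1)^(-1) = 1 (truncated subtraction
-- gives exactly this: 1 ^ 0 = 1).
cayley : ℕ → ℕ
cayley k = suc k ^ (k ∸ 1)

module RingSum {c ℓ : Level} (R : CommutativeRing c ℓ) where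
  open CommutativeRing R public
    using (Carrier; _≈_; _+_; -_; 0#; 1#) renaming (_*_ to _*ᴿ_)

  Σ₀ : ℕ → (ℕ → Carrier) → Carrier
  Σ₀ zero    f = f 0
  Σ₀ (suc n) f = Σ₀ n f + f (suc n)

  -- n · x = x + … + x (n times), the canonical image of n ∈ ℕ acting on R,
  -- and x ^ k the k-th power in R.
  open import Algebra.Definitions.RawSemiring (Semiring.rawSemiring (CommutativeRing.semiring R)) public
    using () renaming (_×_ to _·_; _^_ to _^ᴿ_)

module Submission where

-- Let D(m,a) count the rooted forests on m vertices with no singleton tree
-- at an index ≥ a.  The combinatorial part shows
--   L(n,k) = D(n,k),  D(m+1,a+1) = D(m,a) + D(m+1,a),  D(m,m) = F(m):
-- Counting counts over explicit enumerations; FunctionalDigraphs/AcyclicMaps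
-- count cycle-free maps from j vertices to k sinks plus those vertices,
-- A(k,j+1) = k(k+j+1)^j, by contracting vertex 0 and using the symmetry of
-- the sinks (k = 1 is Cayley's forest formula); Forests deletes singleton
-- trees.  RingIdentities solves the recursion by inclusion-exclusion,
-- D(m,a) = Σ_l (-1)^(m-l) C(m-a,m-l) F(l); with C(n,k) C(n-k,n-l) = C(n,l) C(l,k)
-- and the binomial theorem this is the second identity, and substituting
-- y ↦ -(y+1) yields the first.

module Counting where

  open import Data.Nat using (ℕ; zero; suc; _+_; _*_; _≤_; z≤n; s≤s)
  open import Data.Nat.Properties using (≤-antisym; +-suc; +-assoc; +-0-commutativeMonoid)
  open import Data.Fin as Fin using (Fin)
  open import Data.List using (List; []; _∷_; map; length; filter; _++_; concatMap; tabulate)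
  open import Data.List.Properties using (length-++; length-map)
  open import Data.List.Membership.Propositional using (_∈_)
  open import Data.List.Membership.Propositional.Properties
    using ( ∈-∃++; ∈-++⁺ˡ; ∈-++⁺ʳ; ∈-++⁻; ∈-filter⁺; ∈-filter⁻; ∈-map⁺; ∈-map⁻
          ; ∈-concatMap⁺; ∈-concatMap⁻)
  open import Data.List.Relation.Unary.Unique.Propositional using (Unique)
  import Data.List.Relation.Unary.Unique.Propositional.Properties as Unique
  open import Data.List.Relation.Unary.AllPairs using ([]; _∷_)
  open import Data.List.Relation.Unary.All using (All; []; _∷_)
  open import Data.List.Relation.Unary.Any as Any using (Any; here; there)
  open import Data.Vec using (Vec; []; _∷_)
  open import Data.Vec.Properties using (∷-injectiveˡ; ∷-injectiveʳ)
  open import Data.Product using (_×_; _,_; proj₂)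
  open import Data.Sum using (inj₁; inj₂)
  open import Data.Empty using (⊥; ⊥-elim)
  open import Relation.Nullary using (Dec; yes; no; ¬_; ¬?)
  open import Relation.Nullary.Decidable using (_×-dec_)
  open import Relation.Unary using (Decidable)
  open import Relation.Binary.PropositionalEquality
  open import Algebra.Properties.CommutativeMonoid.Sum +-0-commutativeMonoid public
    using (sum; ∑-distrib-+; ∑-comm)
  open import Algebra.Properties.CommutativeMonoid.Sum +-0-commutativeMonoid
    using (sum-replicate-zero)
  open import Defs using (allVecs)

  private variable
    A B : Set

  count : {P : A → Set} → Decidable P → List A → ℕ
  count P? xs = length (filter P? xs)

  Enumeration : (A : Set) → List A → Set
  Enumeration A xs = Unique xs × (∀ x → x ∈ xs)

  length-mono-⊆ : {xs ys : List A} → Unique xs → (∀ {x} → x ∈ xs → x ∈ ys) → length xs ≤ length ys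
  length-mono-⊆ {xs = []} _ _ = z≤n
  length-mono-⊆ {xs = x ∷ xs} {ys} (x∉xs ∷ u) xs⊆ys with ∈-∃++ (xs⊆ys (here refl))
  ... | as , bs , refl = subst (suc (length xs) ≤_) (sym length-split)
          (s≤s (length-mono-⊆ u (λ z∈xs → ∈-remove (xs⊆ys (there z∈xs)) (distinct z∈xs x∉xs))))
    where
    length-split : length (as ++ x ∷ bs) ≡ suc (length (as ++ bs))
    length-split = trans (length-++ as) (trans (+-suc (length as) (length bs)) (cong suc (sym (length-++ as))))
    ∈-remove : ∀ {z} → z ∈ as ++ x ∷ bs → z ≢ x → z ∈ as ++ bs
    ∈-remove z∈ z≢x with ∈-++⁻ as z∈
    ... | inj₁ z∈as = ∈-++⁺ˡ z∈as
    ... | inj₂ (here refl) = ⊥-elim (z≢x refl)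
    ... | inj₂ (there z∈bs) = ∈-++⁺ʳ as z∈bs
    distinct : ∀ {z zs} → z ∈ zs → All (x ≢_) zs → z ≢ x
    distinct (here refl) (x≢z ∷ _) refl = x≢z refl
    distinct (there z∈zs) (_ ∷ ps) = distinct z∈zs ps

  unique-map : (φ : A → B) (ψ : B → A) {zs : List A} →
    (∀ {z} → z ∈ zs → ψ (φ z) ≡ z) → Unique zs → Unique (map φ zs)
  unique-map φ ψ {[]} _ [] = []
  unique-map φ ψ {z ∷ zs} inv (z∉zs ∷ u) =
    images-distinct zs z∉zs (λ w∈ → inv (there w∈)) ∷ unique-map φ ψ (λ w∈ → inv (there w∈)) u
    where
    images-distinct : ∀ ws → All (z ≢_) ws → (∀ {w} → w ∈ ws → ψ (φ w) ≡ w) → All (φ z ≢_) (map φ ws)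
    images-distinct [] [] _ = []
    images-distinct (w ∷ ws) (z≢w ∷ ps) inv′ =
      (λ φz≡φw → z≢w (trans (sym (inv (here refl))) (trans (cong ψ φz≡φw) (inv′ (here refl)))))
      ∷ images-distinct ws ps (λ q → inv′ (there q))

  count-bijection : {P : A → Set} {Q : B → Set} (P? : Decidable P) (Q? : Decidable Q) {xs : List A} {ys : List B} →
    Enumeration A xs → Enumeration B ys → (φ : A → B) (ψ : B → A) →
    (∀ x → P x → Q (φ x)) → (∀ y → Q y → P (ψ y)) →
    (∀ x → P x → ψ (φ x) ≡ x) → (∀ y → Q y → φ (ψ y) ≡ y) →
    count P? xs ≡ count Q? ys
  count-bijection {P = P} {Q = Q} P? Q? {xs} {ys} (xs-unique , xs-complete) (ys-unique , ys-complete) φ ψ pq qp ψφ φψ =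
    trans (sym (length-map φ (filter P? xs)))
      (≤-antisym (length-mono-⊆ image-unique image⊆) (length-mono-⊆ (Unique.filter⁺ Q? ys-unique) ⊆image))
    where
    holds : ∀ {x} → x ∈ filter P? xs → P x
    holds x∈ = proj₂ (∈-filter⁻ P? {xs = xs} x∈)
    image-unique : Unique (map φ (filter P? xs))
    image-unique = unique-map φ ψ (λ x∈ → ψφ _ (holds x∈)) (Unique.filter⁺ P? xs-unique)
    image⊆ : ∀ {y} → y ∈ map φ (filter P? xs) → y ∈ filter Q? ys
    image⊆ y∈ with ∈-map⁻ φ y∈
    ... | x , x∈ , refl = ∈-filter⁺ Q? (ys-complete (φ x)) (pq x (holds x∈))
    ⊆image : ∀ {y} → y ∈ filter Q? ys → y ∈ map φ (filter P? xs)
    ⊆image {y} y∈ = subst (_∈ map φ (filter P? xs)) (φψ y Qy)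
                        (∈-map⁺ φ (∈-filter⁺ P? (xs-complete (ψ y)) (qp y Qy)))
      where
      Qy : Q y
      Qy = proj₂ (∈-filter⁻ Q? {xs = ys} y∈)

  count-⇔ : {P Q : A → Set} (P? : Decidable P) (Q? : Decidable Q) (xs : List A) →
    (∀ x → P x → Q x) → (∀ x → Q x → P x) → count P? xs ≡ count Q? xs
  count-⇔ P? Q? [] _ _ = refl
  count-⇔ P? Q? (x ∷ xs) f g with P? x | Q? x
  ... | yes _ | yes _ = cong suc (count-⇔ P? Q? xs f g)
  ... | yes p | no ¬q = ⊥-elim (¬q (f x p))
  ... | no ¬p | yes q = ⊥-elim (¬p (g x q))
  ... | no _  | no _  = count-⇔ P? Q? xs f g

  count-none : {P : A → Set} (P? : Decidable P) (xs : List A) → (∀ x → ¬ P x) → count P? xs ≡ 0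
  count-none P? [] _ = refl
  count-none P? (x ∷ xs) ¬P with P? x
  ... | yes p = ⊥-elim (¬P x p)
  ... | no _  = count-none P? xs ¬P

  count-split : {P Q : A → Set} (P? : Decidable P) (Q? : Decidable Q) (xs : List A) →
    count P? xs ≡ count (λ x → P? x ×-dec Q? x) xs + count (λ x → P? x ×-dec ¬? (Q? x)) xs
  count-split P? Q? [] = refl
  count-split P? Q? (x ∷ xs) with P? x | Q? x
  ... | yes _ | yes _ = cong suc (count-split P? Q? xs)
  ... | yes _ | no _  = trans (cong suc (count-split P? Q? xs)) (sym (+-suc _ _))
  ... | no _  | _     = count-split P? Q? xs

  allVecs-enumeration : (xs : List A) → Enumeration A xs → ∀ k → Enumeration (Vec A k) (allVecs xs k)
  allVecs-enumeration {A = A} xs (xs-unique , xs-complete) k = unique k , complete k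
    where
    complete : ∀ k (v : Vec A k) → v ∈ allVecs xs k
    complete zero [] = here refl
    complete (suc k) (x ∷ v) = ∈-concatMap⁺ (λ y → map (y ∷_) (allVecs xs k))
      (Any.map (λ { refl → ∈-map⁺ (x ∷_) (complete k v) }) (xs-complete x))
    unique : ∀ k → Unique (allVecs xs k)
    unique zero = [] ∷ []
    unique (suc k) = blocks xs xs-unique
      where
      block : A → List (Vec A (suc k))
      block y = map (y ∷_) (allVecs xs k)
      disjoint : ∀ {x} ys → All (x ≢_) ys → ∀ {v} → v ∈ block x → v ∈ concatMap block ys → ⊥
      disjoint {x} ys x∉ys v∈ v∈ys with ∈-map⁻ (x ∷_) v∈
      ... | w , _ , refl = other-heads ys x∉ys (∈-concatMap⁻ block {xs = ys} v∈ys)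
        where
        other-heads : ∀ ys → All (x ≢_) ys → Any (λ y → (x ∷ w) ∈ block y) ys → ⊥
        other-heads (y ∷ _) (x≢y ∷ _) (here w∈) with ∈-map⁻ (y ∷_) w∈
        ... | _ , _ , e = x≢y (∷-injectiveˡ e)
        other-heads (_ ∷ ys) (_ ∷ x∉ys) (there w∈) = other-heads ys x∉ys w∈
      blocks : ∀ ys → Unique ys → Unique (concatMap block ys)
      blocks [] _ = []
      blocks (y ∷ ys) (y∉ys ∷ u) =
        Unique.++⁺ (Unique.map⁺ ∷-injectiveʳ (unique k)) (blocks ys u)
          (λ (v∈ , v∈ys) → disjoint ys y∉ys v∈ v∈ys)

  listSum : List A → (A → ℕ) → ℕ
  listSum [] f = 0
  listSum (x ∷ xs) f = f x + listSum xs f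

  listSum-++ : (xs ys : List A) (f : A → ℕ) → listSum (xs ++ ys) f ≡ listSum xs f + listSum ys f
  listSum-++ [] ys f = refl
  listSum-++ (x ∷ xs) ys f = trans (cong (f x +_) (listSum-++ xs ys f)) (sym (+-assoc (f x) _ _))

  listSum-tabulate : ∀ n (h : Fin n → A) (f : A → ℕ) → listSum (tabulate h) f ≡ sum (λ i → f (h i))
  listSum-tabulate zero h f = refl
  listSum-tabulate (suc n) h f = cong (f (h Fin.zero) +_) (listSum-tabulate n (λ i → h (Fin.suc i)) f)

  count-++ : {P : A → Set} (P? : Decidable P) (xs ys : List A) → count P? (xs ++ ys) ≡ count P? xs + count P? ys
  count-++ P? [] ys = refl
  count-++ P? (x ∷ xs) ys with P? x
  ... | yes _ = cong suc (count-++ P? xs ys)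
  ... | no _  = count-++ P? xs ys

  count-map : {P : B → Set} (P? : Decidable P) (h : A → B) (xs : List A) →
    count P? (map h xs) ≡ count (λ x → P? (h x)) xs
  count-map P? h [] = refl
  count-map P? h (x ∷ xs) with P? (h x)
  ... | yes _ = cong suc (count-map P? h xs)
  ... | no _  = count-map P? h xs

  count-concatMap : {P : B → Set} (P? : Decidable P) (f : A → List B) (xs : List A) →
    count P? (concatMap f xs) ≡ listSum xs (λ x → count P? (f x))
  count-concatMap P? f [] = refl
  count-concatMap P? f (x ∷ xs) =
    trans (count-++ P? (f x) (concatMap f xs)) (cong (count P? (f x) +_) (count-concatMap P? f xs))

  count-allVecs-suc : ∀ {k} {P : Vec A (suc k) → Set} (P? : Decidable P) (xs : List A) →
    count P? (allVecs xs (suc k)) ≡ listSum xs (λ x → count (λ v → P? (x ∷ v)) (allVecs xs k))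
  count-allVecs-suc {k = k} P? xs =
    trans (count-concatMap P? (λ x → map (x ∷_) (allVecs xs k)) xs)
          (listSum-cong xs (λ x → count-map P? (x ∷_) (allVecs xs k)))
    where
    listSum-cong : (ys : List A) {f g : A → ℕ} → (∀ y → f y ≡ g y) → listSum ys f ≡ listSum ys g
    listSum-cong [] _ = refl
    listSum-cong (y ∷ ys) f≗g = cong₂ _+_ (f≗g y) (listSum-cong ys f≗g)

  sum-const : ∀ n c → sum {n} (λ _ → c) ≡ n * c
  sum-const zero c = refl
  sum-const (suc n) c = cong (c +_) (sum-const n c)

  sum-cong : ∀ n {f g : Fin n → ℕ} → (∀ i → f i ≡ g i) → sum f ≡ sum g
  sum-cong zero _ = refl
  sum-cong (suc n) f≗g = cong₂ _+_ (f≗g Fin.zero) (sum-cong n (λ i → f≗g (Fin.suc i)))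

  indicator : {P : Set} → Dec P → ℕ
  indicator (yes _) = 1
  indicator (no _) = 0

  indicator-⇔ : {P Q : Set} (p : Dec P) (q : Dec Q) → (P → Q) → (Q → P) → indicator p ≡ indicator q
  indicator-⇔ (yes _) (yes _) _ _ = refl
  indicator-⇔ (yes p) (no ¬q) f _ = ⊥-elim (¬q (f p))
  indicator-⇔ (no ¬p) (yes q) _ g = ⊥-elim (¬p (g q))
  indicator-⇔ (no _) (no _) _ _ = refl

  indicator-no : {P : Set} (p : Dec P) → ¬ P → indicator p ≡ 0
  indicator-no (yes p) ¬p = ⊥-elim (¬p p)
  indicator-no (no _) _ = refl

  count-∷ : {P : A → Set} (P? : Decidable P) (x : A) (xs : List A) → count P? (x ∷ xs) ≡ indicator (P? x) + count P? xs
  count-∷ P? x xs with P? x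
  ... | yes _ = refl
  ... | no _  = refl

  sum-indicator-≡ : ∀ K (e₀ : Fin K) → sum (λ e → indicator (e₀ Fin.≟ e)) ≡ 1
  sum-indicator-≡ (suc K) Fin.zero = cong suc (trans
    (sum-cong K (λ e → indicator-no (Fin.zero Fin.≟ Fin.suc e) (λ ())))
    (sum-replicate-zero K))
  sum-indicator-≡ (suc K) (Fin.suc e₀) = cong₂ _+_
    (indicator-no (Fin.suc e₀ Fin.≟ Fin.zero) (λ ()))
    (trans (sum-cong K (λ e → indicator-⇔ (Fin.suc e₀ Fin.≟ Fin.suc e) (e₀ Fin.≟ e)
                                             (λ { refl → refl }) (λ { refl → refl })))
           (sum-indicator-≡ K e₀))

  count-partition : ∀ {K} {P : A → Set} (P? : Decidable P) (label : A → Fin K) (xs : List A) →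
    sum (λ e → count (λ x → P? x ×-dec (label x Fin.≟ e)) xs) ≡ count P? xs
  count-partition {K = K} P? label [] = sum-replicate-zero K
  count-partition {A = A} {K = K} {P = P} P? label (x ∷ xs) = begin
    sum (λ e → count (P∧label≡ e) (x ∷ xs))
      ≡⟨ sum-cong K (λ e → count-∷ (P∧label≡ e) x xs) ⟩
    sum (λ e → indicator (P∧label≡ e x) + count (P∧label≡ e) xs)
      ≡⟨ ∑-distrib-+ (λ e → indicator (P∧label≡ e x)) _ ⟩
    sum (λ e → indicator (P∧label≡ e x)) + sum (λ e → count (P∧label≡ e) xs)
      ≡⟨ cong₂ _+_ head (count-partition P? label xs) ⟩
    indicator (P? x) + count P? xs
      ≡˘⟨ count-∷ P? x xs ⟩
    count P? (x ∷ xs) ∎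
    where
    open ≡-Reasoning
    P∧label≡ : ∀ e → Decidable (λ (y : A) → P y × label y ≡ e)
    P∧label≡ e y = P? y ×-dec (label y Fin.≟ e)
    head : sum (λ e → indicator (P∧label≡ e x)) ≡ indicator (P? x)
    head with P? x
    ... | yes p = trans (sum-cong K (λ e → indicator-⇔ (yes p ×-dec (label x Fin.≟ e)) (label x Fin.≟ e) proj₂ (p ,_)))
                        (sum-indicator-≡ K (label x))
    ... | no ¬p = trans (sum-cong K (λ e → indicator-no (no ¬p ×-dec (label x Fin.≟ e)) (λ (p , _) → ¬p p)))
                        (sum-replicate-zero K)


module FunctionalDigraphs where

  open import Data.Nat using (ℕ; zero; suc; _+_; _*_; _∸_; _≤_; _<_; _≤?_)
  open import Data.Nat.Properties
  open import Data.Nat.Induction using (<-rec)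
  open import Data.Fin using (Fin; toℕ)
  open import Data.Fin.Properties using (pigeonhole; toℕ<n)
  open import Data.Vec using (Vec; lookup)
  open import Data.Sum using (_⊎_; inj₁; inj₂)
  open import Data.Product using (_×_; _,_; ∃₂)
  open import Data.Empty using (⊥-elim)
  open import Relation.Nullary using (Dec; yes; no; ¬_)
  open import Relation.Binary.PropositionalEquality
  open import Defs using (iter)

  iter-+ : ∀ {A : Set} (f : A → A) a b x → iter f (a + b) x ≡ iter f a (iter f b x)
  iter-+ f zero b x = refl
  iter-+ f (suc a) b x = cong f (iter-+ f a b x)

  iter-sucʳ : ∀ {A : Set} (f : A → A) t x → iter f (suc t) x ≡ iter f t (f x)
  iter-sucʳ f t x = trans (cong (λ u → iter f u x) (+-comm 1 t)) (iter-+ f t 1 x)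

  iter-periodic : ∀ {A : Set} (h : A → A) p z → iter h p z ≡ z → ∀ q → iter h (q * p) z ≡ z
  iter-periodic h p z cycle zero = refl
  iter-periodic h p z cycle (suc q) =
    trans (iter-+ h p (q * p) z) (trans (cong (iter h p) (iter-periodic h p z cycle q)) cycle)

  -- Points of a digraph with k external points (sinks) and j internal vertices.
  Point : ℕ → ℕ → Set
  Point k j = Fin k ⊎ Fin j

  PointMap : ℕ → ℕ → Set
  PointMap k j = Vec (Point k j) j

  next : ∀ {k j} → PointMap k j → Point k j → Point k j
  next g (inj₁ e) = inj₁ e
  next g (inj₂ v) = lookup g v

  data IsExternal {k j : ℕ} : Point k j → Set where
    external : ∀ e → IsExternal (inj₁ e)

  isExternal? : ∀ {k j} (x : Point k j) → Dec (IsExternal x)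
  isExternal? (inj₁ e) = yes (external e)
  isExternal? (inj₂ v) = no (λ ())

  Acyclic : ∀ {k j} → PointMap k j → Set
  Acyclic {k} {j} g = ∀ (v : Fin j) → IsExternal (iter (next g) j (inj₂ v))

  internal-not-external : ∀ {k j} {v : Fin j} → ¬ IsExternal {k} {j} (inj₂ v)
  internal-not-external ()

  external-fixed : ∀ {k j} (g : PointMap k j) t {x} → IsExternal x → iter (next g) t x ≡ x
  external-fixed g zero _ = refl
  external-fixed g (suc t) (external e) = cong (next g) (external-fixed g t (external e))

  external-mono : ∀ {k j} (g : PointMap k j) {s t} x → s ≤ t →
    IsExternal (iter (next g) s x) → IsExternal (iter (next g) t x)
  external-mono g {s} {t} x s≤t ext = subst IsExternal (sym stays) ext
    where
    open ≡-Reasoning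
    stays : iter (next g) t x ≡ iter (next g) s x
    stays = begin
      iter (next g) t x                       ≡˘⟨ cong (λ u → iter (next g) u x) (m∸n+n≡m s≤t) ⟩
      iter (next g) ((t ∸ s) + s) x           ≡⟨ iter-+ (next g) (t ∸ s) s x ⟩
      iter (next g) (t ∸ s) (iter (next g) s x) ≡⟨ external-fixed g (t ∸ s) ext ⟩
      iter (next g) s x                       ∎

  -- A path that is internal up to time b and returns at time b to its
  -- position at an earlier time a is periodic, hence never external.
  periodic-internal : ∀ {k j} (g : PointMap k j) x {a b} → a < b →
    iter (next g) a x ≡ iter (next g) b x →
    (∀ s → s ≤ b → ¬ IsExternal (iter (next g) s x)) → ∀ t → ¬ IsExternal (iter (next g) t x)
  periodic-internal {k} {j} g x {a} {b} a<b return early = <-rec (λ t → ¬ IsExternal (F t)) later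
    where
    F : ℕ → Point k j
    F t = iter (next g) t x
    shift : ∀ r → F (r + b) ≡ F (r + a)
    shift r = trans (iter-+ (next g) r b x) (trans (cong (iter (next g) r) (sym return)) (sym (iter-+ (next g) r a x)))
    later : ∀ t → (∀ {u} → u < t → ¬ IsExternal (F u)) → ¬ IsExternal (F t)
    later t rec with t ≤? b
    ... | yes t≤b = early t t≤b
    ... | no t≰b = λ ext → rec earlier (subst IsExternal back ext)
      where
      b≤t : b ≤ t
      b≤t = <⇒≤ (≰⇒> t≰b)
      back : F t ≡ F ((t ∸ b) + a)
      back = trans (cong F (sym (m∸n+n≡m b≤t))) (shift (t ∸ b))
      earlier : (t ∸ b) + a < t
      earlier = ≤-trans (+-monoʳ-< (t ∸ b) a<b) (≤-reflexive (m∸n+n≡m b≤t))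

  internal-vertex : ∀ {k j} (y : Point k j) → ¬ IsExternal y → Fin j
  internal-vertex (inj₁ e) internal = ⊥-elim (internal (external e))
  internal-vertex (inj₂ v) _ = v

  internal-vertex-≡ : ∀ {k j} (y : Point k j) (internal : ¬ IsExternal y) → y ≡ inj₂ (internal-vertex y internal)
  internal-vertex-≡ (inj₁ e) internal = ⊥-elim (internal (external e))
  internal-vertex-≡ (inj₂ v) _ = refl

  -- Pigeonhole: a path that is still internal after j steps has repeated a
  -- vertex among its first j+1 positions, so it stays internal forever.
  internal-forever : ∀ {k j} (g : PointMap k j) x → ¬ IsExternal (iter (next g) j x) →
    ∀ t → ¬ IsExternal (iter (next g) t x)
  internal-forever {k} {j} g x internal-j = repeated (pigeonhole ≤-refl vertexAt)
    where
    F : ℕ → Point k j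
    F t = iter (next g) t x
    early : ∀ s → s ≤ j → ¬ IsExternal (F s)
    early s s≤j ext-s = internal-j (external-mono g x s≤j ext-s)
    vertexAt : Fin (suc j) → Fin j
    vertexAt s = internal-vertex (F (toℕ s)) (early (toℕ s) (≤-pred (toℕ<n s)))
    repeated : (∃₂ λ a b → toℕ a < toℕ b × vertexAt a ≡ vertexAt b) → ∀ t → ¬ IsExternal (F t)
    repeated (a , b , a<b , same) = periodic-internal g x a<b same-point (λ s s≤b → early s (≤-trans s≤b b≤j))
      where
      b≤j : toℕ b ≤ j
      b≤j = ≤-pred (toℕ<n b)
      same-point : F (toℕ a) ≡ F (toℕ b)
      same-point = trans (internal-vertex-≡ (F (toℕ a)) _)
                         (trans (cong inj₂ same) (sym (internal-vertex-≡ (F (toℕ b)) _)))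

  reaches-within : ∀ {k j} (g : PointMap k j) x t → IsExternal (iter (next g) t x) → IsExternal (iter (next g) j x)
  reaches-within {k} {j} g x t ext with isExternal? (iter (next g) j x)
  ... | yes ext-j = ext-j
  ... | no internal-j = ⊥-elim (internal-forever g x internal-j t ext)


module AcyclicMaps where

  open import Data.Nat using (ℕ; zero; suc; _+_; _*_; _^_; _≤_; z≤n)
  open import Data.Nat.Properties
  open import Data.Fin using (Fin; zero; suc)
  open import Data.Fin.Permutation using (Permutation; transpose; _⟨$⟩ʳ_; _⟨$⟩ˡ_; inverseˡ; inverseʳ)
  open import Data.Fin.Properties using (all?) renaming (_≟_ to _≟F_)
  open import Data.Vec using (Vec; _∷_) renaming (map to vmap)
  open import Data.Vec.Properties using (lookup-map; map-∘; map-cong; map-id)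
  open import Data.List using (List; _++_; tabulate)
  open import Data.List.Membership.Propositional using (_∈_)
  open import Data.List.Membership.Propositional.Properties using (∈-++⁺ˡ; ∈-++⁺ʳ; ∈-tabulate⁺; ∈-tabulate⁻)
  import Data.List.Relation.Unary.Unique.Propositional.Properties as Unique
  open import Data.Sum using (_⊎_; inj₁; inj₂)
  open import Data.Sum.Properties using (inj₁-injective; inj₂-injective) renaming (≡-dec to ⊎-dec)
  open import Data.Product using (_×_; _,_; ∃)
  open import Data.Empty using (⊥; ⊥-elim)
  open import Relation.Nullary using (Dec; yes; no; ¬_; ¬?)
  open import Relation.Nullary.Decidable using (_×-dec_)
  open import Relation.Unary using (Decidable)
  open import Relation.Binary.PropositionalEquality
  open import Data.Nat.Tactic.RingSolver using (solve-∀)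
  open import Defs using (iter; allVecs)
  open Counting
  open FunctionalDigraphs

  points : ∀ k j → List (Point k j)
  points k j = tabulate inj₁ ++ tabulate inj₂

  points-enumeration : ∀ k j → Enumeration (Point k j) (points k j)
  points-enumeration k j =
    Unique.++⁺ (Unique.tabulate⁺ inj₁-injective) (Unique.tabulate⁺ inj₂-injective) disjoint , complete
    where
    disjoint : ∀ {x} → x ∈ tabulate {n = k} inj₁ × x ∈ tabulate {n = j} inj₂ → ⊥
    disjoint (x∈₁ , x∈₂) with ∈-tabulate⁻ x∈₁ | ∈-tabulate⁻ x∈₂
    ... | _ , refl | _ , ()
    complete : ∀ x → x ∈ points k j
    complete (inj₁ e) = ∈-++⁺ˡ (∈-tabulate⁺ e)
    complete (inj₂ v) = ∈-++⁺ʳ (tabulate inj₁) (∈-tabulate⁺ v)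

  _≟ₚ_ : ∀ {k j} (x y : Point k j) → Dec (x ≡ y)
  _≟ₚ_ = ⊎-dec _≟F_ _≟F_

  acyclic? : ∀ {k j} → Decidable (Acyclic {k} {j})
  acyclic? {k} {j} g = all? (λ v → isExternal? (iter (next g) j (inj₂ v)))

  allPointMaps : ∀ k j → List (PointMap k j)
  allPointMaps k j = allVecs (points k j) j

  allPointMaps-enumeration : ∀ k j → Enumeration (PointMap k j) (allPointMaps k j)
  allPointMaps-enumeration k j = allVecs-enumeration (points k j) (points-enumeration k j) j

  #acyclic : ℕ → ℕ → ℕ
  #acyclic k j = count acyclic? (allPointMaps k j)

  map-inverse : ∀ {A B : Set} {n} (f : A → B) (g : B → A) → (∀ x → g (f x) ≡ x) →
    (v : Vec A n) → vmap g (vmap f v) ≡ v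
  map-inverse f g g∘f v = trans (sym (map-∘ g f v)) (trans (map-cong g∘f v) (map-id v))

  -- Turning the internal vertex 0 into a new external point 0 (the old
  -- external points are shifted up by one), and back.
  toSink : ∀ {k j} → Point k (suc j) → Point (suc k) j
  toSink (inj₁ e) = inj₁ (suc e)
  toSink (inj₂ zero) = inj₁ zero
  toSink (inj₂ (suc u)) = inj₂ u

  fromSink : ∀ {k j} → Point (suc k) j → Point k (suc j)
  fromSink (inj₁ zero) = inj₂ zero
  fromSink (inj₁ (suc e)) = inj₁ e
  fromSink (inj₂ u) = inj₂ (suc u)

  fromSink-toSink : ∀ {k j} (x : Point k (suc j)) → fromSink (toSink x) ≡ x
  fromSink-toSink (inj₁ e) = refl
  fromSink-toSink (inj₂ zero) = refl
  fromSink-toSink (inj₂ (suc u)) = refl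

  toSink-fromSink : ∀ {k j} (x : Point (suc k) j) → toSink (fromSink x) ≡ x
  toSink-fromSink (inj₁ zero) = refl
  toSink-fromSink (inj₁ (suc e)) = refl
  toSink-fromSink (inj₂ u) = refl

  toSink-new : ∀ {k j} (y : Point k (suc j)) → toSink y ≡ inj₁ zero → y ≡ inj₂ zero
  toSink-new (inj₂ zero) _ = refl

  toSink-external : ∀ {k j} (y : Point k (suc j)) → IsExternal y → IsExternal (toSink y)
  toSink-external (inj₁ e) (external .e) = external (suc e)

  toSink-external⁻ : ∀ {k j} (y : Point k (suc j)) → IsExternal (toSink y) → IsExternal y ⊎ y ≡ inj₂ zero
  toSink-external⁻ (inj₁ e) _ = inj₁ (external e)
  toSink-external⁻ (inj₂ zero) _ = inj₂ refl

  -- Comparing the map f = x ∷ v (vertex 0 points to x) with the map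
  -- g = toSink ∘ v, in which vertex 0 has become the new sink 0: paths
  -- agree until the g-path enters the new sink, i.e. the f-path enters vertex 0.
  module Contract {k j : ℕ} (x : Point k (suc j)) (v : Vec (Point k (suc j)) j) where
    f : PointMap k (suc j)
    f = x ∷ v
    g : PointMap (suc k) j
    g = vmap toSink v
    fPath : ℕ → Point k (suc j) → Point k (suc j)
    fPath = iter (next f)
    gPath : ℕ → Point (suc k) j → Point (suc k) j
    gPath = iter (next g)

    next-toSink : ∀ y → y ≢ inj₂ zero → toSink (next f y) ≡ next g (toSink y)
    next-toSink (inj₁ e) _ = refl
    next-toSink (inj₂ zero) y≢0 = ⊥-elim (y≢0 refl)
    next-toSink (inj₂ (suc u)) _ = sym (lookup-map u toSink v)

    paths-agree : ∀ t y → gPath t (toSink y) ≢ inj₁ zero → toSink (fPath t y) ≡ gPath t (toSink y)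
    paths-agree zero y _ = refl
    paths-agree (suc t) y avoids with gPath t (toSink y) ≟ₚ inj₁ zero
    ... | yes at-sink = ⊥-elim (avoids (cong (next g) at-sink))
    ... | no ¬at-sink = trans (next-toSink (fPath t y) (λ e → ¬at-sink (trans (sym agree) (cong toSink e))))
                              (cong (next g) agree)
      where
      agree : toSink (fPath t y) ≡ gPath t (toSink y)
      agree = paths-agree t y ¬at-sink

    visits-0 : ∀ t y → gPath t (toSink y) ≡ inj₁ zero → ∃ λ s → s ≤ t × fPath s y ≡ inj₂ zero
    visits-0 zero y at-sink = 0 , z≤n , toSink-new y at-sink
    visits-0 (suc t) y at-sink with gPath t (toSink y) ≟ₚ inj₁ zero
    ... | yes earlier = let (s , s≤t , p) = visits-0 t y earlier in s , m≤n⇒m≤1+n s≤t , p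
    ... | no ¬earlier = suc t , ≤-refl , toSink-new (fPath (suc t) y)
        (trans (next-toSink (fPath t y) (λ e → ¬earlier (trans (sym agree) (cong toSink e))))
               (trans (cong (next g) agree) at-sink))
      where
      agree : toSink (fPath t y) ≡ gPath t (toSink y)
      agree = paths-agree t y ¬earlier

    external-f⇒g : ∀ t y → IsExternal (fPath t y) → IsExternal (gPath t (toSink y))
    external-f⇒g t y ext with gPath t (toSink y) ≟ₚ inj₁ zero
    ... | yes at-sink = subst IsExternal (sym at-sink) (external zero)
    ... | no ¬at-sink = subst IsExternal (paths-agree t y ¬at-sink) (toSink-external _ ext)

    acyclic-f⇒g : Acyclic f → Acyclic g
    acyclic-f⇒g acyclic-f w =
      reaches-within g (inj₂ w) (suc j) (external-f⇒g (suc j) (inj₂ (suc w)) (acyclic-f (suc w)))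

    acyclic-g⇒f : (∃ λ N → IsExternal (fPath N (inj₂ zero))) → Acyclic g → Acyclic f
    acyclic-g⇒f (N , ext₀) _ zero = reaches-within f (inj₂ zero) N ext₀
    acyclic-g⇒f (N , ext₀) acyclic-g (suc w) with gPath j (inj₂ w) ≟ₚ inj₁ zero
    ... | yes at-sink = let (s , _ , p) = visits-0 j (inj₂ (suc w)) at-sink in
          reaches-within f (inj₂ (suc w)) (N + s)
            (subst IsExternal (sym (trans (iter-+ (next f) N s (inj₂ (suc w))) (cong (fPath N) p))) ext₀)
    ... | no ¬at-sink with toSink-external⁻ (fPath j (inj₂ (suc w)))
                            (subst IsExternal (sym (paths-agree j (inj₂ (suc w)) ¬at-sink)) (acyclic-g w))
    ...   | inj₁ ext = external-mono f (inj₂ (suc w)) (n≤1+n j) ext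
    ...   | inj₂ at-0 = ⊥-elim (¬at-sink (trans (sym (paths-agree j (inj₂ (suc w)) ¬at-sink)) (cong toSink at-0)))

  endpoint : ∀ {k j} → PointMap k j → Fin j → Point k j
  endpoint {k} {j} g u = iter (next g) j (inj₂ u)

  -- Classifying the maps on j+1 vertices by the target of vertex 0:
  -- (a) an external point e: f is acyclic iff the contracted map is;
  head-external : ∀ {k j} (e : Fin k) (v : Vec (Point k (suc j)) j) →
    Acyclic (inj₁ e ∷ v) → Acyclic (vmap toSink v)
  head-external e v = Contract.acyclic-f⇒g (inj₁ e) v

  head-external⁻ : ∀ {k j} (e : Fin k) (v : Vec (Point k (suc j)) j) →
    Acyclic (vmap toSink v) → Acyclic (inj₁ e ∷ v)
  head-external⁻ e v = Contract.acyclic-g⇒f (inj₁ e) v (1 , external e)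

  -- (b) vertex 0 itself: a loop, never acyclic;
  head-loop : ∀ {k j} (v : Vec (Point k (suc j)) j) → ¬ Acyclic (inj₂ zero ∷ v)
  head-loop {k} {j} v acyclic = internal-not-external (subst IsExternal (stuck (suc j)) (acyclic zero))
    where
    stuck : ∀ t → iter (next (inj₂ zero ∷ v)) t (inj₂ zero) ≡ inj₂ zero
    stuck zero = refl
    stuck (suc t) = cong (next (inj₂ zero ∷ v)) (stuck t)

  -- (c) another vertex 1+u: f is acyclic iff the contracted map is acyclic
  -- and u does not end in the new sink (which would close a cycle through 0).
  head-internal : ∀ {k j} (u : Fin j) (v : Vec (Point k (suc j)) j) → Acyclic (inj₂ (suc u) ∷ v) →
    Acyclic (vmap toSink v) × endpoint (vmap toSink v) u ≢ inj₁ zero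
  head-internal {k} {j} u v acyclic-f = acyclic-f⇒g acyclic-f , no-cycle
    where
    open Contract (inj₂ (suc u)) v
    no-cycle : endpoint g u ≢ inj₁ zero
    no-cycle at-sink with visits-0 j (inj₂ (suc u)) at-sink
    ... | s , _ , returns = internal-not-external (subst IsExternal (iter-periodic (next f) (suc s) (inj₂ zero) cycle (suc j))
                                (external-mono f (inj₂ zero) (m≤m*n (suc j) (suc s)) (acyclic-f zero)))
      where
      cycle : fPath (suc s) (inj₂ zero) ≡ inj₂ zero
      cycle = trans (iter-sucʳ (next f) s (inj₂ zero)) returns

  head-internal⁻ : ∀ {k j} (u : Fin j) (v : Vec (Point k (suc j)) j) →
    Acyclic (vmap toSink v) → endpoint (vmap toSink v) u ≢ inj₁ zero → Acyclic (inj₂ (suc u) ∷ v)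
  head-internal⁻ {k} {j} u v acyclic-g avoids = acyclic-g⇒f (suc j , from-0) acyclic-g
    where
    open Contract (inj₂ (suc u)) v
    agree : toSink (fPath j (inj₂ (suc u))) ≡ gPath j (inj₂ u)
    agree = paths-agree j (inj₂ (suc u)) avoids
    from-0 : IsExternal (fPath (suc j) (inj₂ zero))
    from-0 with toSink-external⁻ (fPath j (inj₂ (suc u))) (subst IsExternal (sym agree) (acyclic-g u))
    ... | inj₁ ext = subst IsExternal (sym (iter-sucʳ (next f) j (inj₂ zero))) ext
    ... | inj₂ at-0 = ⊥-elim (avoids (trans (sym agree) (cong toSink at-0)))

  relabel : ∀ {k j} → (Fin k → Fin k) → Point k j → Point k j
  relabel σ (inj₁ e) = inj₁ (σ e)
  relabel σ (inj₂ w) = inj₂ w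

  relabel-path : ∀ {k j} (σ : Fin k → Fin k) (g : PointMap k j) t y →
    iter (next (vmap (relabel σ) g)) t (relabel σ y) ≡ relabel σ (iter (next g) t y)
  relabel-path σ g zero y = refl
  relabel-path σ g (suc t) y =
    trans (cong (next (vmap (relabel σ) g)) (relabel-path σ g t y)) (relabel-next (iter (next g) t y))
    where
    relabel-next : ∀ z → next (vmap (relabel σ) g) (relabel σ z) ≡ relabel σ (next g z)
    relabel-next (inj₁ e) = refl
    relabel-next (inj₂ w) = lookup-map w (relabel σ) g

  relabel-acyclic : ∀ {k j} (σ : Fin k → Fin k) (g : PointMap k j) → Acyclic g → Acyclic (vmap (relabel σ) g)
  relabel-acyclic {k} {j} σ g acyclic w =
    subst IsExternal (sym (relabel-path σ g j (inj₂ w))) (relabel-external _ (acyclic w))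
    where
    relabel-external : ∀ (y : Point k j) → IsExternal y → IsExternal (relabel σ y)
    relabel-external (inj₁ e) _ = external (σ e)

  relabel-inverse : ∀ {k j} (σ τ : Fin k → Fin k) → (∀ e → τ (σ e) ≡ e) →
    (y : Point k j) → relabel τ (relabel σ y) ≡ y
  relabel-inverse σ τ τ∘σ (inj₁ e) = cong inj₁ (τ∘σ e)
  relabel-inverse σ τ τ∘σ (inj₂ w) = refl

  -- The label of an external point (0 for internal points, which do not
  -- occur as endpoints of acyclic maps).
  sinkLabel : ∀ {k j} → Point (suc k) j → Fin (suc k)
  sinkLabel (inj₁ e) = e
  sinkLabel (inj₂ _) = zero

  sinkLabel-zero : ∀ {k j} (y : Point (suc k) j) → IsExternal y → sinkLabel y ≡ zero → y ≡ inj₁ zero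
  sinkLabel-zero (inj₁ e) _ e≡0 = cong inj₁ e≡0

  sinkLabel-relabel : ∀ {k j} (σ : Fin (suc k) → Fin (suc k)) (g : PointMap (suc k) j) u → Acyclic g →
    sinkLabel (endpoint (vmap (relabel σ) g) u) ≡ σ (sinkLabel (endpoint g u))
  sinkLabel-relabel {k} {j} σ g u acyclic =
    trans (cong sinkLabel (relabel-path σ g j (inj₂ u))) (external-label _ (acyclic u))
    where
    external-label : ∀ (y : Point (suc k) j) → IsExternal y → sinkLabel (relabel σ y) ≡ σ (sinkLabel y)
    external-label (inj₁ e) _ = refl

  EndsIn? : ∀ {k j} (u : Fin j) (e : Fin (suc k)) →
    Decidable (λ (g : PointMap (suc k) j) → Acyclic g × sinkLabel (endpoint g u) ≡ e)
  EndsIn? u e g = acyclic? g ×-dec (sinkLabel (endpoint g u) ≟F e)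

  -- Symmetry: the number of acyclic maps in which u ends in the sink e
  -- does not depend on e (swap the labels 0 and e).
  ends-in-symmetric : ∀ {k j} (u : Fin j) (e : Fin (suc k)) →
    count (EndsIn? u zero) (allPointMaps (suc k) j) ≡ count (EndsIn? u e) (allPointMaps (suc k) j)
  ends-in-symmetric {k} {j} u e =
    count-bijection (EndsIn? u zero) (EndsIn? u e) (allPointMaps-enumeration (suc k) j) (allPointMaps-enumeration (suc k) j)
      swap swap⁻¹
      (λ g (acyclic , ends) → relabel-acyclic _ g acyclic ,
        trans (sinkLabel-relabel _ g u acyclic) (cong (π ⟨$⟩ʳ_) ends))
      (λ g (acyclic , ends) → relabel-acyclic _ g acyclic ,
        trans (sinkLabel-relabel _ g u acyclic) (trans (cong (π ⟨$⟩ˡ_) ends) (inverseˡ π)))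
      (λ g _ → map-inverse _ _ (relabel-inverse _ _ (λ _ → inverseˡ π)) g)
      (λ g _ → map-inverse _ _ (relabel-inverse _ _ (λ _ → inverseʳ π)) g)
    where
    π : Permutation (suc k) (suc k)
    π = transpose zero e
    swap swap⁻¹ : PointMap (suc k) j → PointMap (suc k) j
    swap = vmap (relabel (π ⟨$⟩ʳ_))
    swap⁻¹ = vmap (relabel (π ⟨$⟩ˡ_))

  module Recursion (k j : ℕ) where
    tails : List (Vec (Point k (suc j)) j)
    tails = allVecs (points k (suc j)) j

    tails-enumeration : Enumeration (Vec (Point k (suc j)) j) tails
    tails-enumeration = allVecs-enumeration (points k (suc j)) (points-enumeration k (suc j)) j

    maps : List (PointMap (suc k) j)
    maps = allPointMaps (suc k) j

    withHead : Point k (suc j) → ℕ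
    withHead x = count (λ v → acyclic? (x ∷ v)) tails

    A′ : ℕ
    A′ = #acyclic (suc k) j

    contract-bijection : {P : Vec (Point k (suc j)) j → Set} {Q : PointMap (suc k) j → Set}
      (P? : Decidable P) (Q? : Decidable Q) → (∀ v → P v → Q (vmap toSink v)) → (∀ g → Q g → P (vmap fromSink g)) →
      count P? tails ≡ count Q? maps
    contract-bijection P? Q? pq qp = count-bijection P? Q? tails-enumeration (allPointMaps-enumeration (suc k) j)
      (vmap toSink) (vmap fromSink) pq qp
      (λ v _ → map-inverse toSink fromSink fromSink-toSink v) (λ g _ → map-inverse fromSink toSink toSink-fromSink g)

    expand : ∀ (g : PointMap (suc k) j) → vmap toSink (vmap fromSink g) ≡ g
    expand = map-inverse fromSink toSink toSink-fromSink

    withHead-external : ∀ e → withHead (inj₁ e) ≡ A′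
    withHead-external e = contract-bijection _ acyclic? (head-external e)
      (λ g acyclic → head-external⁻ e (vmap fromSink g) (subst Acyclic (sym (expand g)) acyclic))

    withHead-loop : withHead (inj₂ zero) ≡ 0
    withHead-loop = count-none (λ v → acyclic? (inj₂ zero ∷ v)) tails head-loop

    avoiding : Fin j → ℕ
    avoiding u = count (λ g → acyclic? g ×-dec ¬? (sinkLabel (endpoint g u) ≟F zero)) maps

    withHead-internal : ∀ u → withHead (inj₂ (suc u)) ≡ avoiding u
    withHead-internal u = contract-bijection _ _
      (λ v acyclic-f → let (acyclic-g , avoids) = head-internal u v acyclic-f in
        acyclic-g , λ label≡0 → avoids (sinkLabel-zero _ (acyclic-g u) label≡0))
      (λ g (acyclic-g , label≢0) → head-internal⁻ u (vmap fromSink g) (subst Acyclic (sym (expand g)) acyclic-g)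
        (λ ends → label≢0 (cong sinkLabel (subst (λ h → endpoint h u ≡ inj₁ zero) (expand g) ends))))

    ending : Fin j → ℕ
    ending u = count (EndsIn? u zero) maps

    decompose : #acyclic k (suc j) ≡ k * A′ + sum avoiding
    decompose = begin
      #acyclic k (suc j)                                      ≡⟨ count-allVecs-suc acyclic? (points k (suc j)) ⟩
      listSum (tabulate inj₁ ++ tabulate inj₂) withHead       ≡⟨ listSum-++ (tabulate inj₁) (tabulate inj₂) withHead ⟩
      listSum (tabulate inj₁) withHead + listSum (tabulate inj₂) withHead
        ≡⟨ cong₂ _+_ (listSum-tabulate k inj₁ withHead) (listSum-tabulate (suc j) inj₂ withHead) ⟩
      sum (λ e → withHead (inj₁ e)) + (withHead (inj₂ zero) + sum (λ u → withHead (inj₂ (suc u))))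
        ≡⟨ cong₂ _+_ (trans (sum-cong k withHead-external) (sum-const k A′))
                     (cong₂ _+_ withHead-loop (sum-cong j withHead-internal)) ⟩
      k * A′ + sum avoiding                                   ∎
      where open ≡-Reasoning

    ending+avoiding : sum ending + sum avoiding ≡ j * A′
    ending+avoiding = begin
      sum ending + sum avoiding                    ≡˘⟨ ∑-distrib-+ ending avoiding ⟩
      sum (λ u → ending u + avoiding u)
        ≡˘⟨ sum-cong j (λ u → count-split acyclic? (λ g → sinkLabel (endpoint g u) ≟F zero) maps) ⟩
      sum {j} (λ _ → A′)                           ≡⟨ sum-const j A′ ⟩
      j * A′                                       ∎
      where open ≡-Reasoning

    -- by symmetry, each of the k+1 sinks receives u equally often
    ending-symmetric : suc k * sum ending ≡ j * A′
    ending-symmetric = begin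
      suc k * sum ending                                          ≡˘⟨ sum-const (suc k) (sum ending) ⟩
      sum {suc k} (λ e → sum ending)
        ≡⟨ sum-cong (suc k) (λ e → sum-cong j (λ u → ends-in-symmetric u e)) ⟩
      sum (λ e → sum (λ u → count (EndsIn? u e) maps))
        ≡⟨ ∑-comm (λ e u → count (EndsIn? u e) maps) ⟩
      sum (λ u → sum (λ e → count (EndsIn? u e) maps))
        ≡⟨ sum-cong j (λ u → count-partition acyclic? (λ g → sinkLabel (endpoint g u)) maps) ⟩
      sum {j} (λ u → A′)                                          ≡⟨ sum-const j A′ ⟩
      j * A′                                                      ∎
      where open ≡-Reasoning

    recursion : suc k * #acyclic k (suc j) ≡ k * A′ * (suc k + j)
    recursion = begin
      suc k * #acyclic k (suc j)                  ≡⟨ cong (suc k *_) decompose ⟩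
      suc k * (k * A′ + sum avoiding)             ≡⟨ *-distribˡ-+ (suc k) (k * A′) (sum avoiding) ⟩
      suc k * (k * A′) + suc k * sum avoiding     ≡⟨ cong (suc k * (k * A′) +_) avoiding-total ⟩
      suc k * (k * A′) + k * (j * A′)             ≡⟨ solve k A′ j ⟩
      k * A′ * (suc k + j)                        ∎
      where
      open ≡-Reasoning
      solve : ∀ k a j → suc k * (k * a) + k * (j * a) ≡ k * a * (suc k + j)
      solve = solve-∀
      avoiding-total : suc k * sum avoiding ≡ k * (j * A′)
      avoiding-total = +-cancelˡ-≡ (j * A′) _ _ (begin
        j * A′ + suc k * sum avoiding                  ≡˘⟨ cong (_+ suc k * sum avoiding) ending-symmetric ⟩
        suc k * sum ending + suc k * sum avoiding      ≡˘⟨ *-distribˡ-+ (suc k) (sum ending) (sum avoiding) ⟩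
        suc k * (sum ending + sum avoiding)            ≡⟨ cong (suc k *_) ending+avoiding ⟩
        j * A′ + k * (j * A′)                          ∎)

  -- A(k, j+1) = k (k+j+1)^j; for k = 1 this is Cayley's count (m+1)^(m-1)
  -- of rooted forests on m vertices.
  #acyclic-formula : ∀ k j → #acyclic k (suc j) ≡ k * (k + suc j) ^ j
  #acyclic-formula k zero = *-cancelˡ-≡ _ _ (suc k) (trans (Recursion.recursion k 0) (solve k))
    where
    solve : ∀ k → k * 1 * (suc k + 0) ≡ suc k * (k * 1)
    solve = solve-∀
  #acyclic-formula k (suc j) = *-cancelˡ-≡ _ _ (suc k) (begin
    suc k * #acyclic k (suc (suc j))                     ≡⟨ Recursion.recursion k (suc j) ⟩
    k * #acyclic (suc k) (suc j) * (suc k + suc j)       ≡⟨ cong (λ a → k * a * (suc k + suc j)) (#acyclic-formula (suc k) j) ⟩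
    k * (suc k * (suc k + suc j) ^ j) * (suc k + suc j)  ≡⟨ cong (λ N → k * (suc k * N ^ j) * N) (sym (+-suc k (suc j))) ⟩
    k * (suc k * N ^ j) * N                              ≡⟨ solve k (N ^ j) N ⟩
    suc k * (k * (N * N ^ j))                            ∎)
    where
    open ≡-Reasoning
    N : ℕ
    N = k + suc (suc j)
    solve : ∀ k P N → k * (suc k * P) * N ≡ suc k * (k * (N * P))
    solve = solve-∀


module Forests where

  open import Data.Nat using (ℕ; zero; suc; _+_; _*_; _^_; _≤_; _<_; z≤n; s≤s; _≤?_; _≟_)
  open import Data.Nat.Properties
  open import Data.Fin using (Fin; zero; suc; toℕ; punchIn; punchOut; fromℕ<)
  open import Data.Fin.Properties
    using ( all?; toℕ-injective; toℕ-fromℕ<; toℕ<n; punchInᵢ≢i; punchOut-punchIn; punchIn-punchOut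
          ; punchOut-cong; punchIn-injective)
    renaming (_≟_ to _≟F_)
  open import Data.Maybe using (Maybe; nothing; just)
  open import Data.Maybe.Properties using (just-injective)
  open import Data.List using (List; _∷_; map; allFin)
  open import Data.List.Membership.Propositional using (_∈_)
  open import Data.List.Membership.Propositional.Properties using (∈-map⁺; ∈-map⁻; ∈-allFin)
  open import Data.List.Relation.Unary.AllPairs using (_∷_)
  import Data.List.Relation.Unary.All as All
  open import Data.List.Relation.Unary.Any using (here; there)
  open import Data.List.Relation.Unary.Unique.Propositional using (Unique)
  import Data.List.Relation.Unary.Unique.Propositional.Properties as Unique
  open import Data.Vec using (Vec; []; _∷_; lookup; insertAt; removeAt) renaming (map to vmap)
  open import Data.Vec.Properties
    using (lookup-map; insertAt-lookup; insertAt-punchIn; removeAt-punchOut; removeAt-insertAt; insertAt-removeAt)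
  open import Data.Sum using (_⊎_; inj₁; inj₂)
  open import Data.Sum.Properties using (inj₂-injective)
  open import Data.Product using (_×_; _,_; ∃; proj₁)
  open import Data.Empty using (⊥-elim)
  open import Relation.Nullary using (Dec; yes; no; ¬_; ¬?)
  open import Relation.Nullary.Decidable using (_×-dec_; _→-dec_)
  open import Relation.Unary using (Decidable)
  open import Relation.Binary.PropositionalEquality
  open import Defs using (iter; step; ParentMap; allParentMaps; IsForest; IsSingleton; LCond; LCond?; L; cayley)
  open Counting
  open FunctionalDigraphs
  open AcyclicMaps

  -- A rooted forest on m vertices is an acyclic map with one external point
  -- (roots point to it).  {v} is a singleton tree: v is a root and a leaf.
  Singleton : ∀ {m} → PointMap 1 m → Fin m → Set
  Singleton g v = lookup g v ≡ inj₁ zero × (∀ u → lookup g u ≢ inj₂ v)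

  singleton? : ∀ {m} (g : PointMap 1 m) (v : Fin m) → Dec (Singleton g v)
  singleton? g v = (lookup g v ≟ₚ inj₁ zero) ×-dec all? (λ u → ¬? (lookup g u ≟ₚ inj₂ v))

  punchIn-split : ∀ {m} (p v : Fin (suc m)) → v ≡ p ⊎ ∃ λ w → v ≡ punchIn p w
  punchIn-split p v with p ≟F v
  ... | yes p≡v = inj₁ (sym p≡v)
  ... | no p≢v = inj₂ (punchOut p≢v , sym (punchIn-punchOut p≢v))

  module Deletion {m : ℕ} (p : Fin (suc m)) where
    lift : Point 1 m → Point 1 (suc m)
    lift (inj₁ e) = inj₁ e
    lift (inj₂ w) = inj₂ (punchIn p w)

    lower : Point 1 (suc m) → Point 1 m
    lower (inj₁ e) = inj₁ e
    lower (inj₂ x) with p ≟F x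
    ... | yes _ = inj₁ zero
    ... | no p≢x = inj₂ (punchOut p≢x)

    lower-lift : ∀ y → lower (lift y) ≡ y
    lower-lift (inj₁ e) = refl
    lower-lift (inj₂ w) with p ≟F punchIn p w
    ... | yes p≡w = ⊥-elim (punchInᵢ≢i p w (sym p≡w))
    ... | no _ = cong inj₂ (trans (punchOut-cong p refl) (punchOut-punchIn p))

    lift-lower : ∀ y → y ≢ inj₂ p → lift (lower y) ≡ y
    lift-lower (inj₁ e) _ = refl
    lift-lower (inj₂ x) y≢p with p ≟F x
    ... | yes refl = ⊥-elim (y≢p refl)
    ... | no p≢x = cong inj₂ (punchIn-punchOut p≢x)

    insert : PointMap 1 m → PointMap 1 (suc m)
    insert g = insertAt (vmap lift g) p (inj₁ zero)

    delete : PointMap 1 (suc m) → PointMap 1 m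
    delete f = vmap lower (removeAt f p)

    insert-at-p : ∀ g → lookup (insert g) p ≡ inj₁ zero
    insert-at-p g = insertAt-lookup (vmap lift g) p (inj₁ zero)

    insert-elsewhere : ∀ g w → lookup (insert g) (punchIn p w) ≡ lift (lookup g w)
    insert-elsewhere g w = trans (insertAt-punchIn (vmap lift g) p (inj₁ zero) w) (lookup-map w lift g)

    insert-path : ∀ g t y → iter (next (insert g)) t (lift y) ≡ lift (iter (next g) t y)
    insert-path g zero y = refl
    insert-path g (suc t) y = trans (cong (next (insert g)) (insert-path g t y)) (lift-next (iter (next g) t y))
      where
      lift-next : ∀ z → next (insert g) (lift z) ≡ lift (next g z)
      lift-next (inj₁ e) = refl
      lift-next (inj₂ w) = insert-elsewhere g w

    lift-external : ∀ y → IsExternal y → IsExternal (lift y)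
    lift-external (inj₁ e) _ = external e

    lift-external⁻ : ∀ y → IsExternal (lift y) → IsExternal y
    lift-external⁻ (inj₁ e) _ = external e

    insert-acyclic : ∀ g → Acyclic g → Acyclic (insert g)
    insert-acyclic g acyclic v with punchIn-split p v
    ... | inj₁ refl = reaches-within (insert g) (inj₂ p) 1 (subst IsExternal (sym (insert-at-p g)) (external zero))
    ... | inj₂ (w , refl) = external-mono (insert g) (inj₂ (punchIn p w)) (n≤1+n m)
          (subst IsExternal (sym (insert-path g m (inj₂ w))) (lift-external _ (acyclic w)))

    insert-acyclic⁻ : ∀ g → Acyclic (insert g) → Acyclic g
    insert-acyclic⁻ g acyclic w = reaches-within g (inj₂ w) (suc m)
      (lift-external⁻ _ (subst IsExternal (insert-path g (suc m) (inj₂ w)) (acyclic (punchIn p w))))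

    lift-≢-p : ∀ y → lift y ≢ inj₂ p
    lift-≢-p (inj₂ w) lift≡p = punchInᵢ≢i p w (inj₂-injective lift≡p)

    insert-singleton : ∀ g → Singleton (insert g) p
    insert-singleton g = insert-at-p g , not-parent
      where
      not-parent : ∀ u → lookup (insert g) u ≢ inj₂ p
      not-parent u with punchIn-split p u
      ... | inj₁ refl = λ e → case (trans (sym (insert-at-p g)) e)
        where case : inj₁ zero ≢ inj₂ p
              case ()
      ... | inj₂ (w , refl) = λ e → lift-≢-p (lookup g w) (trans (sym (insert-elsewhere g w)) e)

    lift-injective₂ : ∀ y w → lift y ≡ inj₂ (punchIn p w) → y ≡ inj₂ w
    lift-injective₂ (inj₂ w′) w e = cong inj₂ (punchIn-injective p w′ w (inj₂-injective e))

    insert-singleton-punchIn : ∀ g w → Singleton (insert g) (punchIn p w) → Singleton g w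
    insert-singleton-punchIn g w (root , leaf) = root′ (lookup g w) (trans (sym (insert-elsewhere g w)) root) ,
      λ u e → leaf (punchIn p u) (trans (insert-elsewhere g u) (cong lift e))
      where
      root′ : ∀ y → lift y ≡ inj₁ zero → y ≡ inj₁ zero
      root′ (inj₁ zero) _ = refl

    insert-singleton-punchIn⁻ : ∀ g w → Singleton g w → Singleton (insert g) (punchIn p w)
    insert-singleton-punchIn⁻ g w (root , leaf) = trans (insert-elsewhere g w) (cong lift root) , not-parent
      where
      not-parent : ∀ u → lookup (insert g) u ≢ inj₂ (punchIn p w)
      not-parent u with punchIn-split p u
      ... | inj₁ refl = λ e → case (trans (sym (insert-at-p g)) e)
        where case : inj₁ zero ≢ inj₂ (punchIn p w)
              case ()
      ... | inj₂ (u′ , refl) = λ e → leaf u′ (lift-injective₂ (lookup g u′) w (trans (sym (insert-elsewhere g u′)) e))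

    delete-insert : ∀ g → delete (insert g) ≡ g
    delete-insert g = trans (cong (vmap lower) (removeAt-insertAt (vmap lift g) p (inj₁ zero))) (map-inverse lift lower lower-lift g)

    insert-delete : ∀ f → Singleton f p → insert (delete f) ≡ f
    insert-delete f (root , leaf) = begin
      insertAt (vmap lift (vmap lower (removeAt f p))) p (inj₁ zero)
        ≡⟨ cong₂ (λ a b → insertAt a p b) (lift-lower-all (removeAt f p) not-p) (sym root) ⟩
      insertAt (removeAt f p) p (lookup f p) ≡⟨ insertAt-removeAt f p ⟩
      f ∎
      where
      open ≡-Reasoning
      not-p : ∀ i → lookup (removeAt f p) i ≢ inj₂ p
      not-p i e = leaf (punchIn p i) (trans (sym (removeAt-lookup i)) e)
        where
        removeAt-lookup : ∀ i → lookup (removeAt f p) i ≡ lookup f (punchIn p i)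
        removeAt-lookup i = trans (cong (lookup (removeAt f p)) (sym (punchOut-punchIn p)))
                                  (removeAt-punchOut f (λ e → punchInᵢ≢i p i (sym e)))
      lift-lower-all : ∀ {n} (w : Vec (Point 1 (suc m)) n) → (∀ i → lookup w i ≢ inj₂ p) → vmap lift (vmap lower w) ≡ w
      lift-lower-all [] _ = refl
      lift-lower-all (y ∷ w) avoids = cong₂ _∷_ (lift-lower y (avoids zero)) (lift-lower-all w (λ i → avoids (suc i)))

  NoSingletonFrom : ∀ {m} → ℕ → PointMap 1 m → Set
  NoSingletonFrom {m} a g = ∀ (v : Fin m) → a ≤ toℕ v → ¬ Singleton g v

  noSingletonFrom? : ∀ {m} (a : ℕ) → Decidable (NoSingletonFrom {m} a)
  noSingletonFrom? a g = all? (λ v → (a ≤? toℕ v) →-dec ¬? (singleton? g v))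

  D : ℕ → ℕ → ℕ
  D m a = count (λ g → acyclic? g ×-dec noSingletonFrom? a g) (allPointMaps 1 m)

  punchIn-above : ∀ {m} (p : Fin (suc m)) (w : Fin m) → toℕ p < toℕ (punchIn p w) → toℕ p ≤ toℕ w
  punchIn-above zero w _ = z≤n
  punchIn-above (suc p) (suc w) (s≤s p<w) = s≤s (punchIn-above p w p<w)

  punchIn-above⁻ : ∀ {m} (p : Fin (suc m)) (w : Fin m) → toℕ p ≤ toℕ w → toℕ p < toℕ (punchIn p w)
  punchIn-above⁻ zero w _ = s≤s z≤n
  punchIn-above⁻ (suc p) (suc w) (s≤s p≤w) = s≤s (punchIn-above⁻ p w p≤w)

  delete-singleton : ∀ {m} (p : Fin (suc m)) →
    count (λ f → acyclic? f ×-dec (singleton? f p ×-dec noSingletonFrom? (suc (toℕ p)) f)) (allPointMaps 1 (suc m))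
    ≡ D m (toℕ p)
  delete-singleton {m} p = count-bijection _ _ (allPointMaps-enumeration 1 (suc m)) (allPointMaps-enumeration 1 m)
    delete insert
    (λ f (acyclic , single , none) → let f≡ = insert-delete f single in
      insert-acyclic⁻ (delete f) (subst Acyclic (sym f≡) acyclic) ,
      none-above⁻ (delete f) (subst (NoSingletonFrom _) (sym f≡) none))
    (λ g (acyclic , none) → insert-acyclic g acyclic , insert-singleton g , none-above g none)
    (λ f (_ , single , _) → insert-delete f single)
    (λ g _ → delete-insert g)
    where
    open Deletion p
    none-above⁻ : ∀ g → NoSingletonFrom (suc (toℕ p)) (insert g) → NoSingletonFrom (toℕ p) g
    none-above⁻ g none w p≤w single = none (punchIn p w) (punchIn-above⁻ p w p≤w) (insert-singleton-punchIn⁻ g w single)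
    none-above : ∀ g → NoSingletonFrom (toℕ p) g → NoSingletonFrom (suc (toℕ p)) (insert g)
    none-above g none v p<v single with punchIn-split p v
    ... | inj₁ refl = <-irrefl refl p<v
    ... | inj₂ (w , refl) = none w (punchIn-above p w p<v) (insert-singleton-punchIn g w single)

  -- With no restriction, D m m counts all rooted forests: Cayley's (m+1)^(m-1).
  D-diagonal : ∀ m → D m m ≡ cayley m
  D-diagonal zero = refl
  D-diagonal (suc m) = begin
    D (suc m) (suc m)
      ≡⟨ count-⇔ _ acyclic? (allPointMaps 1 (suc m)) (λ _ → proj₁)
                 (λ g acyclic → acyclic , λ v m≤v → ⊥-elim (<⇒≱ (toℕ<n v) m≤v)) ⟩
    #acyclic 1 (suc m)     ≡⟨ #acyclic-formula 1 m ⟩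
    1 * (1 + suc m) ^ m    ≡⟨ *-identityˡ _ ⟩
    cayley (suc m)         ∎
    where open ≡-Reasoning

  -- Splitting according to whether {a} is a singleton tree:
  -- D(m+1, a+1) = D(m, a) + D(m+1, a) for a ≤ m.
  D-recursion : ∀ m a → a ≤ m → D (suc m) (suc a) ≡ D m a + D (suc m) a
  D-recursion m a a≤m = begin
    D (suc m) (suc a)
      ≡⟨ count-split noneAbove? (λ g → singleton? g p) forests ⟩
    count (λ g → noneAbove? g ×-dec singleton? g p) forests + count (λ g → noneAbove? g ×-dec ¬? (singleton? g p)) forests
      ≡⟨ cong₂ _+_ singleton not-singleton ⟩
    D m a + D (suc m) a ∎
    where
    open ≡-Reasoning
    forests : List (PointMap 1 (suc m))
    forests = allPointMaps 1 (suc m)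
    p : Fin (suc m)
    p = fromℕ< (s≤s a≤m)
    toℕ-p : toℕ p ≡ a
    toℕ-p = toℕ-fromℕ< (s≤s a≤m)
    noneAbove? : Decidable (λ (g : PointMap 1 (suc m)) → Acyclic g × NoSingletonFrom (suc a) g)
    noneAbove? g = acyclic? g ×-dec noSingletonFrom? (suc a) g
    not-singleton : count (λ g → noneAbove? g ×-dec ¬? (singleton? g p)) forests ≡ D (suc m) a
    not-singleton = count-⇔ _ _ forests
      (λ g ((acyclic , none) , ¬single-p) → acyclic , λ v a≤v → at-or-above g v a≤v none ¬single-p)
      (λ g (acyclic , none) → (acyclic , (λ v a<v → none v (<⇒≤ a<v))) , none p (≤-reflexive (sym toℕ-p)))
      where
      at-or-above : ∀ g v → a ≤ toℕ v → NoSingletonFrom (suc a) g → ¬ Singleton g p → ¬ Singleton g v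
      at-or-above g v a≤v none ¬single-p single-v with toℕ v ≟ a
      ... | yes v≡a = ¬single-p (subst (Singleton g) (toℕ-injective (trans v≡a (sym toℕ-p))) single-v)
      ... | no v≢a = none v (≤∧≢⇒< a≤v (λ a≡v → v≢a (sym a≡v))) single-v
    singleton : count (λ g → noneAbove? g ×-dec singleton? g p) forests ≡ D m a
    singleton = begin
      count (λ g → noneAbove? g ×-dec singleton? g p) forests
        ≡⟨ count-⇔ _ _ forests
             (λ g ((acyclic , none) , single) → acyclic , single , subst (λ b → NoSingletonFrom (suc b) g) (sym toℕ-p) none)
             (λ g (acyclic , single , none) → (acyclic , subst (λ b → NoSingletonFrom (suc b) g) toℕ-p none) , single) ⟩
      count (λ f → acyclic? f ×-dec (singleton? f p ×-dec noSingletonFrom? (suc (toℕ p)) f)) forests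
        ≡⟨ delete-singleton p ⟩
      D m (toℕ p) ≡⟨ cong (D m) toℕ-p ⟩
      D m a ∎

  toPoint : ∀ {m} → Maybe (Fin m) → Point 1 m
  toPoint nothing = inj₁ zero
  toPoint (just v) = inj₂ v

  fromPoint : ∀ {m} → Point 1 m → Maybe (Fin m)
  fromPoint (inj₁ _) = nothing
  fromPoint (inj₂ v) = just v

  toPoint-fromPoint : ∀ {m} (y : Point 1 m) → toPoint (fromPoint y) ≡ y
  toPoint-fromPoint (inj₁ zero) = refl
  toPoint-fromPoint (inj₂ v) = refl

  fromPoint-toPoint : ∀ {m} (y : Maybe (Fin m)) → fromPoint (toPoint y) ≡ y
  fromPoint-toPoint nothing = refl
  fromPoint-toPoint (just v) = refl

  toPoint-injective : ∀ {m} {y z : Maybe (Fin m)} → toPoint y ≡ toPoint z → y ≡ z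
  toPoint-injective {y = y} {z} e = trans (sym (fromPoint-toPoint y)) (trans (cong fromPoint e) (fromPoint-toPoint z))

  allParentMaps-enumeration : ∀ m → Enumeration (ParentMap m) (allParentMaps m)
  allParentMaps-enumeration m = allVecs-enumeration (nothing ∷ map just (allFin m)) (unique , complete) m
    where
    unique : Unique (nothing ∷ map just (allFin m))
    unique = All.tabulate (λ y∈ → nothing≢ (∈-map⁻ just y∈)) ∷ Unique.map⁺ just-injective (Unique.allFin⁺ m)
      where
      nothing≢ : ∀ {y : Maybe (Fin m)} → ∃ (λ x → x ∈ allFin m × y ≡ just x) → nothing ≢ y
      nothing≢ (_ , _ , refl) ()
    complete : ∀ y → y ∈ nothing ∷ map just (allFin m)
    complete nothing = here refl
    complete (just v) = there (∈-map⁺ just (∈-allFin v))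

  toPoint-path : ∀ {m} (f : ParentMap m) t y → iter (next (vmap toPoint f)) t (toPoint y) ≡ toPoint (iter (step f) t y)
  toPoint-path f zero y = refl
  toPoint-path f (suc t) y = trans (cong (next (vmap toPoint f)) (toPoint-path f t y)) (toPoint-next (iter (step f) t y))
    where
    toPoint-next : ∀ z → next (vmap toPoint f) (toPoint z) ≡ toPoint (step f z)
    toPoint-next nothing = refl
    toPoint-next (just v) = lookup-map v toPoint f

  forest⇒acyclic : ∀ {m} (f : ParentMap m) → IsForest f → Acyclic (vmap toPoint f)
  forest⇒acyclic {m} f forest v =
    subst IsExternal (sym (trans (toPoint-path f m (just v)) (cong toPoint (forest v)))) (external zero)

  acyclic⇒forest : ∀ {m} (f : ParentMap m) → Acyclic (vmap toPoint f) → IsForest f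
  acyclic⇒forest {m} f acyclic v = root (iter (step f) m (just v)) (subst IsExternal (toPoint-path f m (just v)) (acyclic v))
    where
    root : ∀ (y : Maybe (Fin m)) → IsExternal (toPoint y) → y ≡ nothing
    root nothing _ = refl

  singleton⇒ : ∀ {m} (f : ParentMap m) v → IsSingleton f v → Singleton (vmap toPoint f) v
  singleton⇒ f v (root , leaf) = trans (lookup-map v toPoint f) (cong toPoint root) ,
    λ u e → leaf u (toPoint-injective (trans (sym (lookup-map u toPoint f)) e))

  singleton⇐ : ∀ {m} (f : ParentMap m) v → Singleton (vmap toPoint f) v → IsSingleton f v
  singleton⇐ f v (root , leaf) = toPoint-injective (trans (sym (lookup-map v toPoint f)) root) ,
    λ u e → leaf u (trans (lookup-map u toPoint f) (cong toPoint e))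

  -- L n k counts forests on n+1 vertices with singleton tree {k} and no
  -- singleton tree above k; deleting {k} identifies them with D n k.
  L≡D : ∀ n k → k ≤ n → L n k ≡ D n k
  L≡D n k k≤n = begin
    L n k ≡⟨ count-bijection (LCond? n k) isLForest? (allParentMaps-enumeration (suc n)) (allPointMaps-enumeration 1 (suc n))
               (vmap toPoint) (vmap fromPoint) encode decode
               (λ f _ → map-inverse toPoint fromPoint fromPoint-toPoint f)
               (λ g _ → map-inverse fromPoint toPoint toPoint-fromPoint g) ⟩
    count isLForest? (allPointMaps 1 (suc n)) ≡⟨ delete-singleton p ⟩
    D n (toℕ p) ≡⟨ cong (D n) toℕ-p ⟩
    D n k ∎
    where
    open ≡-Reasoning
    p : Fin (suc n)
    p = fromℕ< (s≤s k≤n)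
    toℕ-p : toℕ p ≡ k
    toℕ-p = toℕ-fromℕ< (s≤s k≤n)
    LForest : PointMap 1 (suc n) → Set
    LForest g = Acyclic g × (Singleton g p × NoSingletonFrom (suc (toℕ p)) g)
    isLForest? : Decidable LForest
    isLForest? g = acyclic? g ×-dec (singleton? g p ×-dec noSingletonFrom? (suc (toℕ p)) g)
    encode : ∀ f → LCond n k f → LForest (vmap toPoint f)
    encode f (forest , single , none) = forest⇒acyclic f forest , singleton⇒ f p (single p toℕ-p) ,
      λ j p<j single-j → none j (subst (_< toℕ j) toℕ-p p<j) (singleton⇐ f j single-j)
    decode : ∀ g → LForest g → LCond n k (vmap fromPoint g)
    decode g lforest with subst LForest (sym (map-inverse fromPoint toPoint toPoint-fromPoint g)) lforest
    ... | acyclic , single , none = acyclic⇒forest f acyclic ,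
      (λ j toℕ-j → singleton⇐ f j (subst (Singleton (vmap toPoint f)) (toℕ-injective (trans toℕ-p (sym toℕ-j))) single)) ,
      λ j k<j single-j → none j (subst (_< toℕ j) (sym toℕ-p) k<j) (singleton⇒ f j single-j)
      where f = vmap fromPoint g


module BinomialCoefficients where

  open import Data.Nat using (_+_; _*_; _∸_; _≤_; _<_; z≤n; _!; NonZero; _≤?_)
  open import Data.Nat.Properties
  open import Data.Nat.DivMod using (m/n*n≡m)
  open import Data.Nat.Combinatorics using (_C_; nCk≡n!/k![n-k]!; k>n⇒nCk≡0; k![n∸k]!∣n!; nCk≡nC[n∸k]; nCn≡1)
  open import Relation.Binary.PropositionalEquality
  open import Relation.Nullary using (yes; no)
  open import Data.Nat.Tactic.RingSolver using (solve-∀)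

  nC0≡1 : ∀ n → n C 0 ≡ 1
  nC0≡1 n = trans (nCk≡nC[n∸k] {0} {n} z≤n) (nCn≡1 n)

  nCk-factorial : ∀ {n k} → k ≤ n → (n C k) * (k ! * (n ∸ k) !) ≡ n !
  nCk-factorial {n} {k} k≤n = trans (cong (_* (k ! * (n ∸ k) !)) (nCk≡n!/k![n-k]! k≤n))
    (m/n*n≡m {{k !* (n ∸ k) !≢0}} (k![n∸k]!∣n! k≤n))

  -- Choosing k elements of an n-set and then n-l of the remaining n-k is
  -- choosing l elements and then k of them:  C(n,k) C(n-k,n-l) = C(n,l) C(l,k).
  subset-of-subset : ∀ n k l → k ≤ n → l ≤ n → (n C k) * ((n ∸ k) C (n ∸ l)) ≡ (n C l) * (l C k)
  subset-of-subset n k l k≤n l≤n with k ≤? l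
  ... | no k≰l = trans (cong ((n C k) *_) (k>n⇒nCk≡0 (∸-monoʳ-< l<k k≤n)))
                 (trans (*-zeroʳ (n C k)) (sym (trans (cong ((n C l) *_) (k>n⇒nCk≡0 l<k)) (*-zeroʳ (n C l)))))
    where
    l<k : l < k
    l<k = ≰⇒> k≰l
  ... | yes k≤l = *-cancelʳ-≡ _ _ (k ! * (l ∸ k) ! * (n ∸ l) !) {{nonZero}} (trans first-k (sym first-l))
    where
    open ≡-Reasoning
    nonZero : NonZero (k ! * (l ∸ k) ! * (n ∸ l) !)
    nonZero = m*n≢0 (k ! * (l ∸ k) !) ((n ∸ l) !)
      {{m*n≢0 (k !) ((l ∸ k) !) {{k !≢0}} {{(l ∸ k) !≢0}}}} {{(n ∸ l) !≢0}}
    difference : (n ∸ k) ∸ (n ∸ l) ≡ l ∸ k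
    difference = +-cancelʳ-≡ (n ∸ l) _ _ (begin
      (n ∸ k) ∸ (n ∸ l) + (n ∸ l) ≡⟨ m∸n+n≡m (∸-monoʳ-≤ n k≤l) ⟩
      n ∸ k                       ≡˘⟨ cong (_∸ k) (m∸n+n≡m l≤n) ⟩
      (n ∸ l + l) ∸ k             ≡⟨ +-∸-assoc (n ∸ l) k≤l ⟩
      n ∸ l + (l ∸ k)             ≡⟨ +-comm (n ∸ l) (l ∸ k) ⟩
      l ∸ k + (n ∸ l)             ∎)
    rearrange₁ : ∀ X Y a b c → X * Y * (a * b * c) ≡ X * (a * (Y * (c * b)))
    rearrange₁ = solve-∀
    rearrange₂ : ∀ X Y a b c → X * Y * (a * b * c) ≡ X * (Y * (a * b) * c)
    rearrange₂ = solve-∀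
    first-k : (n C k) * ((n ∸ k) C (n ∸ l)) * (k ! * (l ∸ k) ! * (n ∸ l) !) ≡ n !
    first-k = begin
      (n C k) * ((n ∸ k) C (n ∸ l)) * (k ! * (l ∸ k) ! * (n ∸ l) !)
        ≡⟨ rearrange₁ (n C k) ((n ∸ k) C (n ∸ l)) (k !) ((l ∸ k) !) ((n ∸ l) !) ⟩
      (n C k) * (k ! * (((n ∸ k) C (n ∸ l)) * ((n ∸ l) ! * (l ∸ k) !)))
        ≡˘⟨ cong (λ d → (n C k) * (k ! * (((n ∸ k) C (n ∸ l)) * ((n ∸ l) ! * d !)))) difference ⟩
      (n C k) * (k ! * (((n ∸ k) C (n ∸ l)) * ((n ∸ l) ! * ((n ∸ k) ∸ (n ∸ l)) !)))
        ≡⟨ cong (λ d → (n C k) * (k ! * d)) (nCk-factorial (∸-monoʳ-≤ n k≤l)) ⟩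
      (n C k) * (k ! * (n ∸ k) !)
        ≡⟨ nCk-factorial k≤n ⟩
      n ! ∎
    first-l : (n C l) * (l C k) * (k ! * (l ∸ k) ! * (n ∸ l) !) ≡ n !
    first-l = begin
      (n C l) * (l C k) * (k ! * (l ∸ k) ! * (n ∸ l) !)  ≡⟨ rearrange₂ (n C l) (l C k) (k !) ((l ∸ k) !) ((n ∸ l) !) ⟩
      (n C l) * ((l C k) * (k ! * (l ∸ k) !) * (n ∸ l) !) ≡⟨ cong (λ d → (n C l) * (d * (n ∸ l) !)) (nCk-factorial k≤l) ⟩
      (n C l) * (l ! * (n ∸ l) !)                         ≡⟨ nCk-factorial l≤n ⟩
      n !                                                 ∎


open import Algebra.Bundles using (CommutativeRing)
open import Level using (Level)

module RingIdentities {c ℓ : Level} (R : CommutativeRing c ℓ) where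

  open import Data.Nat as ℕ using (ℕ; zero; suc; _∸_; _≤_; _<_; z≤n; s≤s)
  import Data.Nat.Properties as ℕ
  open import Data.Nat.Combinatorics using (_C_; k>n⇒nCk≡0; nCk+nC[k+1]≡[n+1]C[k+1])
  open import Data.Fin using (toℕ)
  import Relation.Binary.PropositionalEquality as ≡
  open ≡ using (_≡_)
  open import Defs using (module RingSum; cayley; L)
  open BinomialCoefficients
  open Forests using (D; D-recursion; D-diagonal; L≡D)
  open import Data.Nat.Tactic.RingSolver using (solve-∀)

  open CommutativeRing R
  open RingSum R using (Σ₀; _·_; _^ᴿ_)
  open import Relation.Binary.Reasoning.Setoid setoid
  open import Algebra.Properties.CommutativeSemigroup +-commutativeSemigroup using (interchange)
  open import Algebra.Properties.CommutativeSemigroup *-commutativeSemigroup using (x∙yz≈y∙xz)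
  import Algebra.Properties.Semiring.Mult semiring as Mult
  import Algebra.Properties.Semiring.Exp semiring as Exp
  import Algebra.Properties.CommutativeSemiring.Exp commutativeSemiring as CommExp
  import Algebra.Properties.Ring ring as RingProperties
  import Algebra.Properties.Semiring.Sum semiring as Sum
  import Algebra.Properties.CommutativeSemiring.Binomial commutativeSemiring as BinomialTheorem

  ⟦_⟧ : ℕ → Carrier
  ⟦ n ⟧ = n · 1#

  ⟦+⟧ : ∀ a b → ⟦ a ℕ.+ b ⟧ ≈ ⟦ a ⟧ + ⟦ b ⟧
  ⟦+⟧ a b = Mult.×-homo-+ 1# a b

  ⟦*⟧ : ∀ a b → ⟦ a ℕ.* b ⟧ ≈ ⟦ a ⟧ * ⟦ b ⟧
  ⟦*⟧ = Mult.×1-homo-*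

  ⟦≡⟧ : ∀ {a b} → a ≡ b → ⟦ a ⟧ ≈ ⟦ b ⟧
  ⟦≡⟧ ≡.refl = refl

  ·≈⟦⟧* : ∀ n x → n · x ≈ ⟦ n ⟧ * x
  ·≈⟦⟧* n x = sym (trans (Mult.×-assoc-* n 1# x) (Mult.×-congʳ n (*-identityˡ x)))

  ≡⇒≈ : ∀ {x y} → x ≡ y → x ≈ y
  ≡⇒≈ ≡.refl = refl

  subtractˡ : ∀ {x y z} → x + y ≈ z → y ≈ - x + z
  subtractˡ {x} {y} {z} x+y≈z = begin
    y               ≈˘⟨ +-identityˡ y ⟩
    0# + y          ≈˘⟨ +-congʳ (-‿inverseˡ x) ⟩
    (- x + x) + y   ≈⟨ +-assoc (- x) x y ⟩
    - x + (x + y)   ≈⟨ +-congˡ x+y≈z ⟩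
    - x + z         ∎

  Σ₀-cong : ∀ n {f g : ℕ → Carrier} → (∀ k → k ≤ n → f k ≈ g k) → Σ₀ n f ≈ Σ₀ n g
  Σ₀-cong zero f≈g = f≈g 0 z≤n
  Σ₀-cong (suc n) f≈g = +-cong (Σ₀-cong n (λ k k≤n → f≈g k (ℕ.m≤n⇒m≤1+n k≤n))) (f≈g (suc n) ℕ.≤-refl)

  Σ₀-+ : ∀ n (f g : ℕ → Carrier) → Σ₀ n (λ k → f k + g k) ≈ Σ₀ n f + Σ₀ n g
  Σ₀-+ zero f g = refl
  Σ₀-+ (suc n) f g = trans (+-congʳ (Σ₀-+ n f g)) (interchange _ _ _ _)

  Σ₀-*ˡ : ∀ n a (f : ℕ → Carrier) → a * Σ₀ n f ≈ Σ₀ n (λ k → a * f k)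
  Σ₀-*ˡ zero a f = refl
  Σ₀-*ˡ (suc n) a f = trans (distribˡ a _ _) (+-congʳ (Σ₀-*ˡ n a f))

  Σ₀-*ʳ : ∀ n a (f : ℕ → Carrier) → Σ₀ n f * a ≈ Σ₀ n (λ k → f k * a)
  Σ₀-*ʳ n a f = trans (*-comm _ a) (trans (Σ₀-*ˡ n a f) (Σ₀-cong n (λ k _ → *-comm a (f k))))

  Σ₀-neg : ∀ n (f : ℕ → Carrier) → Σ₀ n (λ k → - f k) ≈ - Σ₀ n f
  Σ₀-neg zero f = refl
  Σ₀-neg (suc n) f = trans (+-congʳ (Σ₀-neg n f)) (RingProperties.-‿+-comm _ _)

  Σ₀-zero : ∀ n (f : ℕ → Carrier) → (∀ k → k ≤ n → f k ≈ 0#) → Σ₀ n f ≈ 0#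
  Σ₀-zero n f f≈0 = trans (Σ₀-cong n f≈0) (zeros n)
    where
    zeros : ∀ n → Σ₀ n (λ _ → 0#) ≈ 0#
    zeros zero = refl
    zeros (suc n) = trans (+-congʳ (zeros n)) (+-identityʳ 0#)

  Σ₀-swap : ∀ n m (f : ℕ → ℕ → Carrier) → Σ₀ n (λ k → Σ₀ m (f k)) ≈ Σ₀ m (λ l → Σ₀ n (λ k → f k l))
  Σ₀-swap zero m f = refl
  Σ₀-swap (suc n) m f = trans (+-congʳ (Σ₀-swap n m f)) (sym (Σ₀-+ m (λ l → Σ₀ n (λ k → f k l)) (f (suc n))))

  Σ₀-truncate : ∀ l n (f : ℕ → Carrier) → l ≤ n → (∀ k → l < k → f k ≈ 0#) → Σ₀ n f ≈ Σ₀ l f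
  Σ₀-truncate l n f l≤n vanish = ≡.subst (λ m → Σ₀ m f ≈ Σ₀ l f) (ℕ.m+[n∸m]≡n l≤n) (drop (n ∸ l))
    where
    drop : ∀ d → Σ₀ (l ℕ.+ d) f ≈ Σ₀ l f
    drop zero = ≡⇒≈ (≡.cong (λ m → Σ₀ m f) (ℕ.+-identityʳ l))
    drop (suc d) = trans (≡⇒≈ (≡.cong (λ m → Σ₀ m f) (ℕ.+-suc l d)))
      (trans (+-cong (drop d) (vanish (suc (l ℕ.+ d)) (s≤s (ℕ.m≤m+n l d)))) (+-identityʳ _))

  Σ₀≈sum : ∀ n (f : ℕ → Carrier) → Σ₀ n f ≈ Sum.sum {suc n} (λ i → f (toℕ i))
  Σ₀≈sum zero f = sym (+-identityʳ (f 0))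
  Σ₀≈sum (suc n) f = trans (Σ₀-first n f) (+-congˡ (Σ₀≈sum n (λ k → f (suc k))))
    where
    Σ₀-first : ∀ n (f : ℕ → Carrier) → Σ₀ (suc n) f ≈ f 0 + Σ₀ n (λ k → f (suc k))
    Σ₀-first zero f = refl
    Σ₀-first (suc n) f = trans (+-congʳ (Σ₀-first n f)) (+-assoc _ _ _)

  1^≈1 : ∀ n → 1# ^ᴿ n ≈ 1#
  1^≈1 zero = refl
  1^≈1 (suc n) = trans (*-identityˡ _) (1^≈1 n)

  binomial : ∀ l N y → l ≤ N → Σ₀ N (λ k → ⟦ l C k ⟧ * y ^ᴿ k) ≈ (y + 1#) ^ᴿ l
  binomial l N y l≤N = begin
    Σ₀ N term                                         ≈⟨ Σ₀-truncate l N term l≤N vanish ⟩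
    Σ₀ l term                                         ≈⟨ Σ₀≈sum l term ⟩
    Sum.sum {suc l} (λ i → term (toℕ i))              ≈⟨ Sum.sum-cong-≋ {suc l} (λ i → library-term (toℕ i)) ⟩
    BinomialTheorem.binomialExpansion y 1# l          ≈˘⟨ BinomialTheorem.theorem l y 1# ⟩
    (y + 1#) ^ᴿ l                                     ∎
    where
    term : ℕ → Carrier
    term k = ⟦ l C k ⟧ * y ^ᴿ k
    vanish : ∀ k → l < k → term k ≈ 0#
    vanish k l<k = trans (*-congʳ (⟦≡⟧ (k>n⇒nCk≡0 l<k))) (zeroˡ _)
    library-term : ∀ k → term k ≈ (l C k) · (y ^ᴿ k * 1# ^ᴿ (l ∸ k))
    library-term k =
      sym (trans (Mult.×-congʳ (l C k) (trans (*-congˡ (1^≈1 (l ∸ k))) (*-identityʳ _))) (·≈⟦⟧* (l C k) _))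

  sign : ℕ → Carrier
  sign i = (- 1#) ^ᴿ i

  sign-suc : ∀ i → sign (suc i) ≈ - sign i
  sign-suc i = RingProperties.-1*x≈-x (sign i)

  sign-+ : ∀ a b → sign (a ℕ.+ b) ≈ sign a * sign b
  sign-+ = Exp.^-homo-* (- 1#)

  sign-square : ∀ i → sign i * sign i ≈ 1#
  sign-square i = begin
    sign i * sign i        ≈˘⟨ CommExp.^-distrib-* (- 1#) (- 1#) i ⟩
    (- 1# * - 1#) ^ᴿ i     ≈⟨ Exp.^-congˡ i (trans (RingProperties.-1*x≈-x (- 1#)) (RingProperties.-‿involutive 1#)) ⟩
    1# ^ᴿ i                ≈⟨ 1^≈1 i ⟩
    1#                     ∎

  sign-split : ∀ n k → k ≤ n → sign (n ∸ k) * sign k ≈ sign n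
  sign-split n k k≤n = trans (sym (sign-+ (n ∸ k) k)) (≡⇒≈ (≡.cong sign (ℕ.m∸n+n≡m k≤n)))

  sign-∸ : ∀ n k → k ≤ n → sign (n ∸ k) ≈ sign n * sign k
  sign-∸ n k k≤n = begin
    sign (n ∸ k)                      ≈˘⟨ *-identityʳ _ ⟩
    sign (n ∸ k) * 1#                 ≈˘⟨ *-congˡ (sign-square k) ⟩
    sign (n ∸ k) * (sign k * sign k)  ≈˘⟨ *-assoc _ _ _ ⟩
    sign (n ∸ k) * sign k * sign k    ≈⟨ *-congʳ (sign-split n k k≤n) ⟩
    sign n * sign k                   ∎

  neg-power : ∀ x k → (- x) ^ᴿ k ≈ sign k * x ^ᴿ k
  neg-power x k = trans (Exp.^-congˡ k (sym (RingProperties.-1*x≈-x x))) (CommExp.^-distrib-* (- 1#) x k)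

  -- The inclusion–exclusion expression for D(m, a):
  --   E(m, a) = Σ_{l ≤ m} (-1)^(m-l) C(m-a, m-l) (l+1)^(l-1).
  ieTerm : ℕ → ℕ → ℕ → Carrier
  ieTerm m a l = sign (m ∸ l) * ⟦ ((m ∸ a) C (m ∸ l)) ℕ.* cayley l ⟧

  E : ℕ → ℕ → Carrier
  E m a = Σ₀ m (ieTerm m a)

  signed-pascal : ∀ N M f → sign (suc M) * ⟦ (suc N C suc M) ℕ.* f ⟧
                          ≈ - (sign M * ⟦ (N C M) ℕ.* f ⟧) + sign (suc M) * ⟦ (N C suc M) ℕ.* f ⟧
  signed-pascal N M f = begin
    sign (suc M) * ⟦ (suc N C suc M) ℕ.* f ⟧
      ≈⟨ *-congˡ (⟦≡⟧ (≡.trans (≡.cong (ℕ._* f) (≡.sym (nCk+nC[k+1]≡[n+1]C[k+1] N M)))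
                               (ℕ.*-distribʳ-+ f (N C M) (N C suc M)))) ⟩
    sign (suc M) * ⟦ (N C M) ℕ.* f ℕ.+ (N C suc M) ℕ.* f ⟧
      ≈⟨ *-congˡ (⟦+⟧ ((N C M) ℕ.* f) ((N C suc M) ℕ.* f)) ⟩
    sign (suc M) * (⟦ (N C M) ℕ.* f ⟧ + ⟦ (N C suc M) ℕ.* f ⟧)
      ≈⟨ distribˡ _ _ _ ⟩
    sign (suc M) * ⟦ (N C M) ℕ.* f ⟧ + sign (suc M) * ⟦ (N C suc M) ℕ.* f ⟧
      ≈⟨ +-congʳ (trans (*-congʳ (sign-suc M)) (sym (RingProperties.-‿distribˡ-* _ _))) ⟩
    - (sign M * ⟦ (N C M) ℕ.* f ⟧) + sign (suc M) * ⟦ (N C suc M) ℕ.* f ⟧ ∎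

  ieTerm-recursion : ∀ m a l → a ≤ m → l ≤ m → ieTerm (suc m) a l ≈ - ieTerm m a l + ieTerm (suc m) (suc a) l
  ieTerm-recursion m a l a≤m l≤m = begin
    ieTerm (suc m) a l
      ≈⟨ ≡⇒≈ (≡.cong₂ (λ u v → sign v * ⟦ (u C v) ℕ.* cayley l ⟧) (ℕ.+-∸-assoc 1 a≤m) suc-m∸l) ⟩
    sign (suc (m ∸ l)) * ⟦ (suc (m ∸ a) C suc (m ∸ l)) ℕ.* cayley l ⟧
      ≈⟨ signed-pascal (m ∸ a) (m ∸ l) (cayley l) ⟩
    - ieTerm m a l + sign (suc (m ∸ l)) * ⟦ ((m ∸ a) C suc (m ∸ l)) ℕ.* cayley l ⟧
      ≈˘⟨ +-congˡ (≡⇒≈ (≡.cong (λ v → sign v * ⟦ ((m ∸ a) C v) ℕ.* cayley l ⟧) suc-m∸l)) ⟩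
    - ieTerm m a l + ieTerm (suc m) (suc a) l ∎
    where
    suc-m∸l : suc m ∸ l ≡ suc (m ∸ l)
    suc-m∸l = ℕ.+-∸-assoc 1 l≤m

  ieTerm-top : ∀ m a → ieTerm m a m ≈ ⟦ cayley m ⟧
  ieTerm-top m a = begin
    sign (m ∸ m) * ⟦ ((m ∸ a) C (m ∸ m)) ℕ.* cayley m ⟧
      ≈⟨ ≡⇒≈ (≡.cong (λ d → sign d * ⟦ ((m ∸ a) C d) ℕ.* cayley m ⟧) (ℕ.n∸n≡0 m)) ⟩
    1# * ⟦ ((m ∸ a) C 0) ℕ.* cayley m ⟧
      ≈⟨ *-identityˡ _ ⟩
    ⟦ ((m ∸ a) C 0) ℕ.* cayley m ⟧
      ≈⟨ ⟦≡⟧ (≡.trans (≡.cong (ℕ._* cayley m) (nC0≡1 (m ∸ a))) (ℕ.*-identityˡ (cayley m))) ⟩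
    ⟦ cayley m ⟧ ∎

  E-recursion : ∀ m a → a ≤ m → E (suc m) a ≈ - E m a + E (suc m) (suc a)
  E-recursion m a a≤m = begin
    Σ₀ m (ieTerm (suc m) a) + ieTerm (suc m) a (suc m)
      ≈⟨ +-cong (Σ₀-cong m (λ l l≤m → ieTerm-recursion m a l a≤m l≤m))
                (trans (ieTerm-top (suc m) a) (sym (ieTerm-top (suc m) (suc a)))) ⟩
    Σ₀ m (λ l → - ieTerm m a l + ieTerm (suc m) (suc a) l) + ieTerm (suc m) (suc a) (suc m)
      ≈⟨ +-congʳ (trans (Σ₀-+ m _ _) (+-congʳ (Σ₀-neg m (ieTerm m a)))) ⟩
    (- E m a + Σ₀ m (ieTerm (suc m) (suc a))) + ieTerm (suc m) (suc a) (suc m)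
      ≈⟨ +-assoc _ _ _ ⟩
    - E m a + E (suc m) (suc a) ∎

  E-diagonal : ∀ m → E m m ≈ ⟦ cayley m ⟧
  E-diagonal zero = ieTerm-top 0 0
  E-diagonal (suc m) = trans (+-cong (Σ₀-zero m _ lower-vanish) (ieTerm-top (suc m) (suc m))) (+-identityˡ _)
    where
    -- C(0, m+1-l) = 0 for l ≤ m
    lower-vanish : ∀ l → l ≤ m → ieTerm (suc m) (suc m) l ≈ 0#
    lower-vanish l l≤m = trans (*-congˡ (⟦≡⟧ (≡.cong (ℕ._* cayley l) empty))) (zeroʳ _)
      where
      empty : (m ∸ m) C (suc m ∸ l) ≡ 0
      empty = ≡.trans (≡.cong (_C (suc m ∸ l)) (ℕ.n∸n≡0 m))
                      (k>n⇒nCk≡0 (≡.subst (0 <_) (≡.sym (ℕ.+-∸-assoc 1 l≤m)) (s≤s z≤n)))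

  D≈E : ∀ m a → a ≤ m → ⟦ D m a ⟧ ≈ E m a
  D≈E m a a≤m = ≡.subst (λ m → ⟦ D m a ⟧ ≈ E m a) (ℕ.m+[n∸m]≡n a≤m) (by-gap (m ∸ a) a)
    where
    by-gap : ∀ d a → ⟦ D (a ℕ.+ d) a ⟧ ≈ E (a ℕ.+ d) a
    by-gap zero a = ≡.subst (λ m → ⟦ D m a ⟧ ≈ E m a) (≡.sym (ℕ.+-identityʳ a))
                            (trans (⟦≡⟧ (D-diagonal a)) (sym (E-diagonal a)))
    by-gap (suc d) a = ≡.subst (λ m → ⟦ D m a ⟧ ≈ E m a) (≡.sym (ℕ.+-suc a d)) (begin
      ⟦ D (suc M) a ⟧                       ≈⟨ subtractˡ recursion ⟩
      - ⟦ D M a ⟧ + ⟦ D (suc M) (suc a) ⟧  ≈⟨ +-cong (-‿cong (by-gap d a)) (by-gap d (suc a)) ⟩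
      - E M a + E (suc M) (suc a)          ≈˘⟨ E-recursion M a a≤M ⟩
      E (suc M) a                          ∎)
      where
      M : ℕ
      M = a ℕ.+ d
      a≤M : a ≤ M
      a≤M = ℕ.m≤m+n a d
      recursion : ⟦ D M a ⟧ + ⟦ D (suc M) a ⟧ ≈ ⟦ D (suc M) (suc a) ⟧
      recursion = sym (trans (⟦≡⟧ (D-recursion M a a≤M)) (⟦+⟧ (D M a) (D (suc M) a)))

  second-identity : ∀ n y → Σ₀ n (λ k → ((n C k) ℕ.* L n k) · (y ^ᴿ k))
                          ≈ Σ₀ n (λ k → ((n C k) ℕ.* cayley k) · (sign (n ∸ k) * (y + 1#) ^ᴿ k))
  second-identity n y = begin
    Σ₀ n (λ k → ((n C k) ℕ.* L n k) · (y ^ᴿ k))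
      ≈⟨ Σ₀-cong n (λ k k≤n → trans (·≈⟦⟧* ((n C k) ℕ.* L n k) (y ^ᴿ k)) (*-congʳ (L-term k k≤n))) ⟩
    Σ₀ n (λ k → (⟦ n C k ⟧ * E n k) * y ^ᴿ k)
      ≈⟨ Σ₀-cong n (λ k _ → trans (*-congʳ (Σ₀-*ˡ n _ (ieTerm n k))) (Σ₀-*ʳ n _ _)) ⟩
    Σ₀ n (λ k → Σ₀ n (λ l → (⟦ n C k ⟧ * ieTerm n k l) * y ^ᴿ k))
      ≈⟨ Σ₀-swap n n _ ⟩
    Σ₀ n (λ l → Σ₀ n (λ k → (⟦ n C k ⟧ * ieTerm n k l) * y ^ᴿ k))
      ≈⟨ Σ₀-cong n (λ l l≤n → Σ₀-cong n (λ k k≤n → regroup k l k≤n l≤n)) ⟩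
    Σ₀ n (λ l → Σ₀ n (λ k → coefficient l * (⟦ l C k ⟧ * y ^ᴿ k)))
      ≈⟨ Σ₀-cong n (λ l l≤n → trans (sym (Σ₀-*ˡ n _ _)) (*-congˡ (binomial l n y l≤n))) ⟩
    Σ₀ n (λ l → coefficient l * (y + 1#) ^ᴿ l)
      ≈⟨ Σ₀-cong n (λ l _ → trans (*-congʳ (*-comm _ _))
                                  (trans (*-assoc _ _ _) (sym (·≈⟦⟧* ((n C l) ℕ.* cayley l) _)))) ⟩
    Σ₀ n (λ k → ((n C k) ℕ.* cayley k) · (sign (n ∸ k) * (y + 1#) ^ᴿ k)) ∎
    where
    coefficient : ℕ → Carrier
    coefficient l = sign (n ∸ l) * ⟦ (n C l) ℕ.* cayley l ⟧
    L-term : ∀ k → k ≤ n → ⟦ (n C k) ℕ.* L n k ⟧ ≈ ⟦ n C k ⟧ * E n k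
    L-term k k≤n = trans (⟦≡⟧ (≡.cong ((n C k) ℕ.*_) (L≡D n k k≤n)))
                         (trans (⟦*⟧ (n C k) (D n k)) (*-congˡ (D≈E n k k≤n)))
    -- C(n,k) C(n-k,n-l) = C(n,l) C(l,k) moves the binomial coefficient to the inner sum
    regroup : ∀ k l → k ≤ n → l ≤ n → (⟦ n C k ⟧ * ieTerm n k l) * y ^ᴿ k ≈ coefficient l * (⟦ l C k ⟧ * y ^ᴿ k)
    regroup k l k≤n l≤n = trans (*-congʳ coefficients) (*-assoc _ _ _)
      where
      naturals : (n C k) ℕ.* (((n ∸ k) C (n ∸ l)) ℕ.* cayley l) ≡ ((n C l) ℕ.* cayley l) ℕ.* (l C k)
      naturals = ≡.trans (≡.sym (ℕ.*-assoc (n C k) _ (cayley l)))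
        (≡.trans (≡.cong (ℕ._* cayley l) (subset-of-subset n k l k≤n l≤n)) (swap (n C l) (l C k) (cayley l)))
        where
        swap : ∀ a b c → a ℕ.* b ℕ.* c ≡ a ℕ.* c ℕ.* b
        swap = solve-∀
      coefficients : ⟦ n C k ⟧ * ieTerm n k l ≈ coefficient l * ⟦ l C k ⟧
      coefficients = begin
        ⟦ n C k ⟧ * (sign (n ∸ l) * ⟦ ((n ∸ k) C (n ∸ l)) ℕ.* cayley l ⟧) ≈⟨ x∙yz≈y∙xz _ _ _ ⟩
        sign (n ∸ l) * (⟦ n C k ⟧ * ⟦ ((n ∸ k) C (n ∸ l)) ℕ.* cayley l ⟧) ≈˘⟨ *-congˡ (⟦*⟧ (n C k) _) ⟩
        sign (n ∸ l) * ⟦ (n C k) ℕ.* (((n ∸ k) C (n ∸ l)) ℕ.* cayley l) ⟧ ≈⟨ *-congˡ (⟦≡⟧ naturals) ⟩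
        sign (n ∸ l) * ⟦ ((n C l) ℕ.* cayley l) ℕ.* (l C k) ⟧             ≈⟨ *-congˡ (⟦*⟧ ((n C l) ℕ.* cayley l) (l C k)) ⟩
        sign (n ∸ l) * (⟦ (n C l) ℕ.* cayley l ⟧ * ⟦ l C k ⟧)              ≈˘⟨ *-assoc _ _ _ ⟩
        coefficient l * ⟦ l C k ⟧                                         ∎

  -- Substituting y ↦ -(y+1) and multiplying by (-1)^n turns an identity
  --   Σ_k a_k y^k = Σ_k b_k (-1)^(n-k) (y+1)^k   (for all y)
  -- into  Σ_k a_k (-1)^(n-k) (y+1)^k = Σ_k b_k y^k.
  reflect : ∀ n (a b : ℕ → ℕ) →
    (∀ z → Σ₀ n (λ k → a k · (z ^ᴿ k)) ≈ Σ₀ n (λ k → b k · (sign (n ∸ k) * (z + 1#) ^ᴿ k))) →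
    ∀ y → Σ₀ n (λ k → a k · (sign (n ∸ k) * (y + 1#) ^ᴿ k)) ≈ Σ₀ n (λ k → b k · (y ^ᴿ k))
  reflect n a b identity y = begin
    Σ₀ n (λ k → a k · (sign (n ∸ k) * (y + 1#) ^ᴿ k))
      ≈˘⟨ Σ₀-cong n (λ k k≤n → trans (Mult.×-comm-* (a k) (sign n) (z ^ᴿ k)) (Mult.×-congʳ (a k) (left k k≤n))) ⟩
    Σ₀ n (λ k → sign n * (a k · (z ^ᴿ k)))                            ≈˘⟨ Σ₀-*ˡ n (sign n) _ ⟩
    sign n * Σ₀ n (λ k → a k · (z ^ᴿ k))                              ≈⟨ *-congˡ (identity z) ⟩
    sign n * Σ₀ n (λ k → b k · (sign (n ∸ k) * (z + 1#) ^ᴿ k))        ≈⟨ Σ₀-*ˡ n (sign n) _ ⟩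
    Σ₀ n (λ k → sign n * (b k · (sign (n ∸ k) * (z + 1#) ^ᴿ k)))
      ≈⟨ Σ₀-cong n (λ k k≤n → trans (Mult.×-comm-* (b k) (sign n) _) (Mult.×-congʳ (b k) (right k k≤n))) ⟩
    Σ₀ n (λ k → b k · (y ^ᴿ k))                                       ∎
    where
    z : Carrier
    z = - (y + 1#)
    z+1≈-y : z + 1# ≈ - y
    z+1≈-y = begin
      - (y + 1#) + 1#    ≈˘⟨ +-congʳ (RingProperties.-‿+-comm y 1#) ⟩
      (- y + - 1#) + 1#  ≈⟨ +-assoc _ _ _ ⟩
      - y + (- 1# + 1#)  ≈⟨ +-congˡ (-‿inverseˡ 1#) ⟩
      - y + 0#           ≈⟨ +-identityʳ _ ⟩
      - y                ∎
    left : ∀ k → k ≤ n → sign n * z ^ᴿ k ≈ sign (n ∸ k) * (y + 1#) ^ᴿ k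
    left k k≤n = begin
      sign n * z ^ᴿ k                     ≈⟨ *-congˡ (neg-power (y + 1#) k) ⟩
      sign n * (sign k * (y + 1#) ^ᴿ k)   ≈˘⟨ *-assoc _ _ _ ⟩
      (sign n * sign k) * (y + 1#) ^ᴿ k   ≈˘⟨ *-congʳ (sign-∸ n k k≤n) ⟩
      sign (n ∸ k) * (y + 1#) ^ᴿ k        ∎
    right : ∀ k → k ≤ n → sign n * (sign (n ∸ k) * (z + 1#) ^ᴿ k) ≈ y ^ᴿ k
    right k k≤n = begin
      sign n * (sign (n ∸ k) * (z + 1#) ^ᴿ k)     ≈⟨ *-congˡ (*-congˡ (trans (Exp.^-congˡ k z+1≈-y) (neg-power y k))) ⟩
      sign n * (sign (n ∸ k) * (sign k * y ^ᴿ k)) ≈˘⟨ *-congˡ (*-assoc _ _ _) ⟩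
      sign n * ((sign (n ∸ k) * sign k) * y ^ᴿ k) ≈⟨ *-congˡ (*-congʳ (sign-split n k k≤n)) ⟩
      sign n * (sign n * y ^ᴿ k)                  ≈˘⟨ *-assoc _ _ _ ⟩
      (sign n * sign n) * y ^ᴿ k                  ≈⟨ *-congʳ (sign-square n) ⟩
      1# * y ^ᴿ k                                 ≈⟨ *-identityˡ _ ⟩
      y ^ᴿ k                                      ∎


open import Defs using (module RingSum; L; cayley)
open import Data.Nat using (ℕ; _∸_; _*_)
open import Data.Nat.Combinatorics using (_C_)
open import Data.Product using (_×_; _,_)

theorem5p2 : ∀ {c ℓ : Level} (R : CommutativeRing c ℓ) (n : ℕ) (y : CommutativeRing.Carrier R) →
    let open RingSum R in (Σ₀ n (λ k → ((n C k) * L n k) · (((- 1#) ^ᴿ (n ∸ k)) *ᴿ ((y + 1#) ^ᴿ k)))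
          ≈ Σ₀ n (λ k → ((n C k) * cayley k) · (y ^ᴿ k)))
     × (Σ₀ n (λ k → ((n C k) * L n k) · (y ^ᴿ k))
          ≈ Σ₀ n (λ k → ((n C k) * cayley k) · (((- 1#) ^ᴿ (n ∸ k)) *ᴿ ((y + 1#) ^ᴿ k))))
theorem5p2 R n y =
    reflect n (λ k → (n C k) * L n k) (λ k → (n C k) * cayley k) (second-identity n) y
  , second-identity n y
  where open RingIdentities R
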